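{- Let $n\ge3$, fix an extroverted triangulation $\tau$ of a convex $n$-gon with vertices $1,\ldots,n$ in cyclic order, and let $\vec\lambda=(\lambda^1,\ldots,\lambda^n)$ be a tuple of minuscule weights of $GL_m$. If two size-$m$ $n$-hives both have boundary $\vec\lambda$ and have the same weight on every oriented interior edge (diagonal) $P_a\to P_b$ of $\tau$, then they are equal.
   Context: $\Delta^n_m=\{(i_1,\ldots,i_n)\in\mathbb{Z}_{\ge 0}^n:\sum i_j=m\}$, $P_a=me_a$. A size-$m$ $3$-hive is an equivalence class modulo constants of $f:\Delta^3_m\to\mathbb{Z}$ satisfying (whenever defined) $f_{i,j,k}+f_{i,j+1,k-1}\ge f_{i+1,j,k-1}+f_{i-1,j+1,k}$, $f_{i,j,k}+f_{i+1,j-1,k}\ge f_{i+1,j,k-1}+f_{i,j-1,k+1}$, $f_{i,j,k}+f_{i+1,j,k-1}\ge f_{i,j+1,k-1}+f_{i+1,j-1,k}$. A size-$m$ $n$-hive is an equivalence class modulo constants of $f:\Delta^n_m\to\mathbb{Z}$ whose restriction to each face $\{i: i_d=0 \text{ for } d\notin\{a,b,c\}\}$ ($a<b<c$) is a $3$-hive and which satisfies the octahedron recurrence $f(i+e_a+e_c)+f(i+e_b+e_d)=\max(f(i+e_a+e_b)+f(i+e_c+e_d),f(i+e_a+e_d)+f(i+e_b+e_c))$ for $\sum i_j=m-2$, $a<b<c<d$. The weight of the oriented edge $P_a\to P_b$ is $(f(x_1)-f(x_0),\ldots,f(x_m)-f(x_{m-1}))$ with $x_t=(m-t)e_a+te_b$;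 it is a dominant weight (weakly decreasing). The boundary of the $n$-hive is $(\lambda^1,\ldots,\lambda^n)$ where $\lambda^a$ is the weight of $P_a\to P_{a+1}$ (indices mod $n$). Minuscule weights: $\omega_i=(1^i,0^{m-i})$, $\omega_i^*=(0^{m-i},(-1)^i)$, $1\le i\le m$. An extroverted triangulation is a triangulation of the $n$-gon in which every triangle shares an edge with the boundary of the polygon. -}

module Defs where

open import Data.Nat as ℕ using (ℕ; zero; suc; _∸_)
open import Data.Nat.DivMod using (_%_; m%n<n)
open import Data.Integer as ℤ using (ℤ; +_; -_; _⊔_)
open import Data.Fin as Fin using (Fin; toℕ; fromℕ<)
open import Data.Fin.Properties using (_≟_)
open import Data.Vec using (Vec; updateAt; tabulate; sum)
open import Data.Product using (_×_; _,_; ∃; Σ)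
open import Data.Sum using (_⊎_)
open import Data.List using (List)
open import Data.List.Membership.Propositional using (_∈_)
open import Relation.Binary.PropositionalEquality using (_≡_; _≢_)
open import Relation.Nullary using (¬_; does)
open import Data.Bool using (if_then_else_)

-- Lattice points of Δ^n_m are vectors p : Vec ℕ n with sum p ≡ m.
-- A hive is represented by a function f : Vec ℕ n → ℤ; only its values
-- on Δ^n_m matter (all conditions and equality are restricted to Δ^n_m).

addE : ∀ {n} → Fin n → Vec ℕ n → Vec ℕ n
addE a p = updateAt p a suc

SupportedOn : ∀ {n} → Fin n → Fin n → Fin n → Vec ℕ n → Set
SupportedOn a b c p =
  ∀ d → d ≢ a → d ≢ b → d ≢ c → Data.Vec.lookup p d ≡ 0

-- The three rhombus inequalities of a 3-hive on the face a<b<c, written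
-- with a base point p (supported on the face, coordinate sum m-2); every
-- point involved is of the form p + e_x + e_y, so these are exactly the
-- inequalities of the definition "whenever defined".
FaceHive : ∀ {n} (m : ℕ) → (Vec ℕ n → ℤ) → Set
FaceHive {n} m f =
  ∀ (a b c : Fin n) → a Fin.< b → b Fin.< c →
  ∀ (p : Vec ℕ n) → SupportedOn a b c p → sum p ℕ.+ 2 ≡ m →
    -- f_{i,j,k}+f_{i,j+1,k-1} ≥ f_{i+1,j,k-1}+f_{i-1,j+1,k}
    (f (addE a (addE a p)) ℤ.+ f (addE b (addE c p))
       ℤ.≤ f (addE a (addE c p)) ℤ.+ f (addE a (addE b p)))
  × -- f_{i,j,k}+f_{i+1,j-1,k} ≥ f_{i+1,j,k-1}+f_{i,j-1,k+1}
    (f (addE a (addE b p)) ℤ.+ f (addE c (addE c p))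
       ℤ.≤ f (addE b (addE c p)) ℤ.+ f (addE a (addE c p)))
  × -- f_{i,j,k}+f_{i+1,j,k-1} ≥ f_{i,j+1,k-1}+f_{i+1,j-1,k}
    (f (addE b (addE b p)) ℤ.+ f (addE a (addE c p))
       ℤ.≤ f (addE b (addE c p)) ℤ.+ f (addE a (addE b p)))

Octahedron : ∀ {n} (m : ℕ) → (Vec ℕ n → ℤ) → Set
Octahedron {n} m f =
  ∀ (p : Vec ℕ n) → sum p ℕ.+ 2 ≡ m →
  ∀ (a b c d : Fin n) → a Fin.< b → b Fin.< c → c Fin.< d →
    f (addE a (addE c p)) ℤ.+ f (addE b (addE d p))
      ≡ (f (addE a (addE b p)) ℤ.+ f (addE c (addE d p)))
        ⊔ (f (addE a (addE d p)) ℤ.+ f (addE b (addE c p)))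

-- f (representing an equivalence class mod constants) is a size-m n-hive
IsHive : (n m : ℕ) → (Vec ℕ n → ℤ) → Set
IsHive n m f = FaceHive {n} m f × Octahedron {n} m f

HiveEq : (n m : ℕ) → (Vec ℕ n → ℤ) → (Vec ℕ n → ℤ) → Set
HiveEq n m f g = ∃ λ (k : ℤ) → ∀ (x : Vec ℕ n) → sum x ≡ m → f x ≡ g x ℤ.+ k

edgePt : ∀ {n} (m : ℕ) → Fin n → Fin n → ℕ → Vec ℕ n
edgePt m a b t = tabulate λ d →
  (if does (d ≟ a) then m ∸ t else 0) ℕ.+ (if does (d ≟ b) then t else 0)

weight : ∀ {n} (m : ℕ) → (Vec ℕ n → ℤ) → Fin n → Fin n → Vec ℤ m
weight m f a b = tabulate λ (t : Fin m) →
  f (edgePt m a b (suc (toℕ t))) ℤ.- f (edgePt m a b (toℕ t))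

next : ∀ {n} → Fin n → Fin n
next {suc k} a = fromℕ< (m%n<n (suc (toℕ a)) (suc k))

HasBoundary : ∀ {n} (m : ℕ) → (Vec ℕ n → ℤ) → (Fin n → Vec ℤ m) → Set
HasBoundary m f λs = ∀ a → weight m f a (next a) ≡ λs a

ω : (m i : ℕ) → Vec ℤ m
ω m i = tabulate λ (t : Fin m) → if toℕ t ℕ.<ᵇ i then + 1 else + 0

ω* : (m i : ℕ) → Vec ℤ m
ω* m i = tabulate λ (t : Fin m) → if (m ∸ i) ℕ.≤ᵇ toℕ t then - (+ 1) else + 0

Minuscule : (m : ℕ) → Vec ℤ m → Set
Minuscule m w = ∃ λ i → 1 ℕ.≤ i × i ℕ.≤ m × (w ≡ ω m i ⊎ w ≡ ω* m i)

BoundaryEdge : ∀ {n} → Fin n → Fin n → Set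
BoundaryEdge a b = b ≡ next a ⊎ a ≡ next b

IsDiagonal : ∀ {n} → Fin n × Fin n → Set
IsDiagonal (a , b) = a Fin.< b × ¬ BoundaryEdge a b

Cross : ∀ {n} → Fin n × Fin n → Fin n × Fin n → Set
Cross (a , b) (c , d) =
  (a Fin.< c × c Fin.< b × b Fin.< d) ⊎ (c Fin.< a × a Fin.< d × d Fin.< b)

IsTriangulation : ∀ {n} → List (Fin n × Fin n) → Set
IsTriangulation {n} D =
    (∀ e → e ∈ D → IsDiagonal e)
  × (∀ e e′ → e ∈ D → e′ ∈ D → ¬ Cross e e′)
  × (∀ e → IsDiagonal e → ¬ (e ∈ D) → ∃ λ e′ → e′ ∈ D × Cross e e′)

TEdge : ∀ {n} → List (Fin n × Fin n) → Fin n → Fin n → Set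
TEdge D a b = BoundaryEdge a b ⊎ (a , b) ∈ D ⊎ (b , a) ∈ D

-- the triangles of the triangulation are the triples a<b<c pairwise joined
-- by edges; extroverted: each triangle has a side on the polygon boundary
Extroverted : ∀ {n} → List (Fin n × Fin n) → Set
Extroverted D =
  ∀ a b c → a Fin.< b → b Fin.< c →
    TEdge D a b → TEdge D b c → TEdge D a c →
    BoundaryEdge a b ⊎ BoundaryEdge b c ⊎ BoundaryEdge a c

module Submission where

open import Defs
open import Data.Nat using (ℕ; suc; _≥_; s≤s; z≤n)
open import Data.Integer using (ℤ)
open import Data.Fin using (Fin)
open import Data.Vec using (Vec)
open import Data.Product using (_×_; _,_)
open import Data.List using (List)
open import Data.List.Membership.Propositional using (_∈_)
open import Relation.Binary.PropositionalEquality using (_≡_)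

-- Let κ = f(P₀) − g(P₀); we show f = g + κ on all of Δ^n_m,
-- spreading this agreement over the polygon piece by piece:
--   * Segments: equal weights on P_u → P_v and agreement at P_u give agreement on [P_u, P_v].
--     Walking around the boundary reaches every vertex, and then every edge of τ.
--   * Faces: on a face {x, y, z} whose side P_x → P_y has a minuscule (two-step) weight, every
--     row parallel to [P_x, P_y] is a staircase, by the rhombus inequalities; a staircase is
--     fixed by its two ends, which lie on the other two sides. As τ is extroverted, every
--     triangle of τ has such a side on the boundary of the polygon.
--   * Gluing: the octahedron recurrence determines a value from five neighbours, so agreement
--     spreads from [P_a, P_c], the triangle (a, c, b) and [P_c, P_b] to the interval [P_a, P_b].
-- Every edge a < b of τ with b > a + 1 is the base of a triangle (a, c, b) of τ; induction on
-- b − a gives agreement on each interval [P_a, P_b], and the closing side [P₀, P_{n−1}] spans Δ^n_m.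

module Points where
  open import Data.Nat using (ℕ; zero; suc; _+_; _≤_; _<_; s≤s)
  open import Data.Nat.Properties as ℕP using ()
  open import Data.Fin as Fin using (Fin)
  open import Data.Fin.Properties using (_≟_)
  open import Data.Vec using (Vec; []; _∷_; sum; lookup; replicate)
  open import Data.Vec.Properties
    using (lookup∘updateAt; lookup∘updateAt′; updateAt-commutes; lookup-replicate)
  open import Data.Bool using (if_then_else_)
  open import Data.Product using (_×_; _,_; ∃)
  open import Data.Sum using (_⊎_; inj₁; inj₂)
  open import Data.Empty using (⊥-elim)
  open import Relation.Binary.PropositionalEquality
  open import Relation.Nullary using (¬_; does; yes; no)
  open import Relation.Unary using (Decidable)
  open import Induction.WellFounded using (module All)
  import Relation.Binary.Construct.On as On
  import Data.Nat.Induction as ℕI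

  vec-ext : ∀ {n} {v w : Vec ℕ n} → (∀ d → lookup v d ≡ lookup w d) → v ≡ w
  vec-ext {v = []} {[]} h = refl
  vec-ext {v = x ∷ v} {y ∷ w} h = cong₂ _∷_ (h Fin.zero) (vec-ext λ d → h (Fin.suc d))

  lookup-addE : ∀ {n} (a : Fin n) (p : Vec ℕ n) → lookup (addE a p) a ≡ suc (lookup p a)
  lookup-addE a p = lookup∘updateAt a p

  lookup-addE′ : ∀ {n} {a d : Fin n} (p : Vec ℕ n) → d ≢ a → lookup (addE a p) d ≡ lookup p d
  lookup-addE′ {a = a} {d} p d≢a = lookup∘updateAt′ d a d≢a p

  addE-comm : ∀ {n} (a b : Fin n) (p : Vec ℕ n) → addE a (addE b p) ≡ addE b (addE a p)
  addE-comm a b p with a ≟ b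
  ... | yes refl = refl
  ... | no a≢b = updateAt-commutes a b a≢b p

  sum-addE : ∀ {n} (a : Fin n) (p : Vec ℕ n) → sum (addE a p) ≡ suc (sum p)
  sum-addE Fin.zero (x ∷ p) = refl
  sum-addE (Fin.suc a) (x ∷ p) = trans (cong (x +_) (sum-addE a p)) (ℕP.+-suc x (sum p))

  sum-addE₂ : ∀ {n} (a b : Fin n) (p : Vec ℕ n) → sum (addE a (addE b p)) ≡ sum p + 2
  sum-addE₂ a b p =
    trans (sum-addE a (addE b p)) (trans (cong suc (sum-addE b p)) (ℕP.+-comm 2 (sum p)))

  peel : ∀ {n} (a : Fin n) (x : Vec ℕ n) → lookup x a ≢ 0 → ∃ λ p → x ≡ addE a p
  peel Fin.zero (zero ∷ x) x₀≢0 = ⊥-elim (x₀≢0 refl)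
  peel Fin.zero (suc t ∷ x) _ = t ∷ x , refl
  peel (Fin.suc a) (t ∷ x) xₐ≢0 with peel a x xₐ≢0
  ... | p , refl = t ∷ p , refl

  peel₂ : ∀ {n} {a b : Fin n} (x : Vec ℕ n) → a ≢ b → lookup x a ≢ 0 → lookup x b ≢ 0 →
          ∃ λ p → x ≡ addE a (addE b p)
  peel₂ {a = a} {b} x a≢b xₐ≢0 x_b≢0 with peel a x xₐ≢0
  ... | y , refl
    with peel b y (λ y_b≡0 → x_b≢0 (trans (lookup-addE′ y λ b≡a → a≢b (sym b≡a)) y_b≡0))
  ...   | p , refl = p , refl

  Supp : ∀ {n} → (Fin n → Set) → Vec ℕ n → Set
  Supp P x = ∀ d → ¬ P d → lookup x d ≡ 0

  supp-weaken : ∀ {n} {P Q : Fin n → Set} {x : Vec ℕ n} → (∀ d → P d → Q d) → Supp P x → Supp Q x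
  supp-weaken P⊆Q s d ¬Qd = s d (λ Pd → ¬Qd (P⊆Q d Pd))

  supp-addE : ∀ {n} {P : Fin n → Set} {a : Fin n} {x : Vec ℕ n} → P a → Supp P x → Supp P (addE a x)
  supp-addE {a = a} {x} Pa s d ¬Pd = trans (lookup-addE′ x λ { refl → ¬Pd Pa }) (s d ¬Pd)

  supp-addE⁻ : ∀ {n} {P : Fin n → Set} {a : Fin n} {x : Vec ℕ n} → Supp P (addE a x) → Supp P x
  supp-addE⁻ {a = a} {x} s d ¬Pd with d ≟ a
  ... | yes refl = ⊥-elim (ℕP.1+n≢0 (trans (sym (lookup-addE a x)) (s d ¬Pd)))
  ... | no d≢a = trans (sym (lookup-addE′ x d≢a)) (s d ¬Pd)

  addEs : ∀ {n} → ℕ → Fin n → Vec ℕ n → Vec ℕ n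
  addEs zero a v = v
  addEs (suc t) a v = addE a (addEs t a v)

  zeros : ∀ {n} → Vec ℕ n
  zeros {n} = replicate n 0

  vertex : ∀ {n} → ℕ → Fin n → Vec ℕ n
  vertex m a = addEs m a zeros

  addE-addEs : ∀ {n} (a b : Fin n) t (v : Vec ℕ n) → addE a (addEs t b v) ≡ addEs t b (addE a v)
  addE-addEs a b zero v = refl
  addE-addEs a b (suc t) v = trans (addE-comm a b (addEs t b v)) (cong (addE b) (addE-addEs a b t v))

  supp-addEs : ∀ {n} {P : Fin n → Set} t {a : Fin n} {v : Vec ℕ n} → (t ≢ 0 → P a) → Supp P v →
               Supp P (addEs t a v)
  supp-addEs zero _ s = s
  supp-addEs {P = P} (suc t) {a} {v} Pa s =
    supp-addE {P = P} {a} {addEs t a v} (Pa (λ ())) (supp-addEs t (λ _ → Pa (λ ())) s)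

  sum-addEs : ∀ {n} t (a : Fin n) (v : Vec ℕ n) → sum (addEs t a v) ≡ t + sum v
  sum-addEs zero a v = refl
  sum-addEs (suc t) a v = trans (sum-addE a (addEs t a v)) (cong suc (sum-addEs t a v))

  sum-zeros : ∀ n → sum (zeros {n}) ≡ 0
  sum-zeros zero = refl
  sum-zeros (suc n) = sum-zeros n

  lookup-zeros : ∀ {n} (d : Fin n) → lookup (zeros {n}) d ≡ 0
  lookup-zeros d = lookup-replicate d 0

  lookup-addEs : ∀ {n} t (a : Fin n) (v : Vec ℕ n) → lookup (addEs t a v) a ≡ t + lookup v a
  lookup-addEs zero a v = refl
  lookup-addEs (suc t) a v = trans (lookup-addE a (addEs t a v)) (cong suc (lookup-addEs t a v))

  lookup-addEs′ : ∀ {n} t {a d : Fin n} (v : Vec ℕ n) → d ≢ a → lookup (addEs t a v) d ≡ lookup v d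
  lookup-addEs′ zero v d≢a = refl
  lookup-addEs′ (suc t) v d≢a = trans (lookup-addE′ (addEs t _ v) d≢a) (lookup-addEs′ t v d≢a)

  mass : ∀ {n} {P : Fin n → Set} → Decidable P → Vec ℕ n → ℕ
  mass {zero} P? [] = 0
  mass {suc n} P? (x ∷ v) = (if does (P? Fin.zero) then x else 0) + mass (λ d → P? (Fin.suc d)) v

  mass-in : ∀ {n} {P : Fin n → Set} (P? : Decidable P) {a : Fin n} (v : Vec ℕ n) → P a →
            mass P? (addE a v) ≡ suc (mass P? v)
  mass-in P? {Fin.zero} (x ∷ v) Pa with P? Fin.zero
  ... | yes _ = refl
  ... | no ¬P = ⊥-elim (¬P Pa)
  mass-in P? {Fin.suc a} (x ∷ v) Pa =
    trans (cong (_ +_) (mass-in (λ d → P? (Fin.suc d)) v Pa)) (ℕP.+-suc _ _)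

  mass-out : ∀ {n} {P : Fin n → Set} (P? : Decidable P) {a : Fin n} (v : Vec ℕ n) → ¬ P a →
             mass P? (addE a v) ≡ mass P? v
  mass-out P? {Fin.zero} (x ∷ v) ¬Pa with P? Fin.zero
  ... | yes Pa = ⊥-elim (¬Pa Pa)
  ... | no _ = refl
  mass-out P? {Fin.suc a} (x ∷ v) ¬Pa = cong (_ +_) (mass-out (λ d → P? (Fin.suc d)) v ¬Pa)

  mass-zero : ∀ {n} {P : Fin n → Set} (P? : Decidable P) (v : Vec ℕ n) → mass P? v ≡ 0 →
              ∀ d → P d → lookup v d ≡ 0
  mass-zero P? (x ∷ v) e Fin.zero Pd with P? Fin.zero
  ... | yes _ = ℕP.m+n≡0⇒m≡0 x e
  ... | no ¬P = ⊥-elim (¬P Pd)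
  mass-zero P? (x ∷ v) e (Fin.suc d) Pd =
    mass-zero (λ d → P? (Fin.suc d)) v (ℕP.m+n≡0⇒n≡0 (if does (P? Fin.zero) then x else 0) e) d Pd

  mass-pos : ∀ {n} {P : Fin n → Set} (P? : Decidable P) (v : Vec ℕ n) → mass P? v ≢ 0 →
             ∃ λ d → P d × lookup v d ≢ 0
  mass-pos P? [] m≢0 = ⊥-elim (m≢0 refl)
  mass-pos P? (x ∷ v) m≢0 with P? Fin.zero | x
  ... | yes P₀ | suc _ = Fin.zero , P₀ , (λ ())
  ... | yes P₀ | zero with mass-pos (λ d → P? (Fin.suc d)) v m≢0
  ...   | d , Pd , v≢0 = Fin.suc d , Pd , v≢0
  mass-pos P? (x ∷ v) m≢0 | no _ | _ with mass-pos (λ d → P? (Fin.suc d)) v m≢0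
  ... | d , Pd , v≢0 = Fin.suc d , Pd , v≢0

  mass-addE-≤ : ∀ {n} {P : Fin n → Set} (P? : Decidable P) (a : Fin n) (v : Vec ℕ n) →
                mass P? (addE a v) ≤ suc (mass P? v)
  mass-addE-≤ P? a v with P? a
  ... | yes Pa = ℕP.≤-reflexive (mass-in P? v Pa)
  ... | no ¬Pa = ℕP.≤-trans (ℕP.≤-reflexive (mass-out P? v ¬Pa)) (ℕP.n≤1+n _)

  mass-addE₂-≤ : ∀ {n} {P : Fin n → Set} (P? : Decidable P) {a b : Fin n} (v : Vec ℕ n) →
                 ¬ P a ⊎ ¬ P b → mass P? (addE a (addE b v)) ≤ suc (mass P? v)
  mass-addE₂-≤ P? {a} {b} v (inj₁ ¬Pa) =
    ℕP.≤-trans (ℕP.≤-reflexive (mass-out P? (addE b v) ¬Pa)) (mass-addE-≤ P? b v)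
  mass-addE₂-≤ P? {a} {b} v (inj₂ ¬Pb) =
    ℕP.≤-trans (mass-addE-≤ P? a (addE b v)) (s≤s (ℕP.≤-reflexive (mass-out P? v ¬Pb)))

  sum-vertex : ∀ {n} m (a : Fin n) → sum (vertex m a) ≡ m
  sum-vertex {n} m a = trans (sum-addEs m a zeros) (trans (cong (m +_) (sum-zeros n)) (ℕP.+-identityʳ m))

  lookup-vertex : ∀ {n} m (a : Fin n) → lookup (vertex m a) a ≡ m
  lookup-vertex m a = trans (lookup-addEs m a zeros) (trans (cong (m +_) (lookup-zeros a)) (ℕP.+-identityʳ m))

  supp-vertex : ∀ {n} {P : Fin n → Set} m {a : Fin n} → P a → Supp P (vertex m a)
  supp-vertex m {a} Pa d ¬Pd = trans (lookup-addEs′ m zeros λ { refl → ¬Pd Pa }) (lookup-zeros d)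

  pair-coordinates : ∀ {n} {u v : Fin n} (w : Vec ℕ n) → u ≢ v → Supp (λ d → d ≡ u ⊎ d ≡ v) w →
                     w ≡ addEs (lookup w u) u (vertex (lookup w v) v)
  pair-coordinates {u = u} {v} w u≢v s = vec-ext coordinate
    where
      off-v : ∀ {d} → d ≢ v → lookup (vertex (lookup w v) v) d ≡ 0
      off-v {d} d≢v = supp-vertex {P = _≡ v} (lookup w v) refl d d≢v
      coordinate : ∀ d → lookup w d ≡ lookup (addEs (lookup w u) u (vertex (lookup w v) v)) d
      coordinate d with d ≟ u | d ≟ v
      ... | yes refl | yes refl = ⊥-elim (u≢v refl)
      ... | yes refl | no d≢v = sym (trans (lookup-addEs (lookup w d) d _)
                                       (trans (cong (lookup w d +_) (off-v d≢v)) (ℕP.+-identityʳ _)))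
      ... | no d≢u | yes refl = sym (trans (lookup-addEs′ (lookup w u) _ d≢u) (lookup-vertex (lookup w d) d))
      ... | no d≢u | no d≢v = trans (s d λ { (inj₁ e) → d≢u e ; (inj₂ e) → d≢v e })
                                    (sym (trans (lookup-addEs′ (lookup w u) _ d≢u) (off-v d≢v)))

  sum-pair : ∀ {n} {u v : Fin n} (w : Vec ℕ n) → u ≢ v → Supp (λ d → d ≡ u ⊎ d ≡ v) w →
             sum w ≡ lookup w u + lookup w v
  sum-pair {u = u} {v} w u≢v s = begin
    sum w                                             ≡⟨ cong sum (pair-coordinates w u≢v s) ⟩
    sum (addEs (lookup w u) u (vertex (lookup w v) v)) ≡⟨ sum-addEs (lookup w u) u _ ⟩
    lookup w u + sum (vertex (lookup w v) v)          ≡⟨ cong (lookup w u +_) (sum-vertex (lookup w v) v) ⟩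
    lookup w u + lookup w v                           ∎
    where open ≡-Reasoning

  mass-induction : ∀ {n} {P : Fin n → Set} (P? : Decidable P) (Goal : Vec ℕ n → Set) →
    (∀ x → (∀ y → mass P? y < mass P? x → Goal y) → Goal x) → ∀ x → Goal x
  mass-induction P? Goal step =
    All.wfRec (On.wellFounded (mass P?) ℕI.<-wellFounded) _ Goal (λ x rec → step x (λ y → rec))

module IntegerFacts where
  open import Data.Integer using (ℤ; +_; -_; _+_; _-_; _≤_; _⊔_)
  open import Data.Integer.Properties as ℤP using ()
  open import Algebra.Properties.AbelianGroup ℤP.+-0-abelianGroup using (∙-cancelʳ)
  open import Data.Integer.Tactic.RingSolver using (solve)
  open import Data.List using (_∷_; [])
  open import Data.Sum using (_⊎_; inj₁; inj₂)
  open import Data.Empty using (⊥-elim)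
  open import Relation.Binary using (tri<; tri≈; tri>)
  open import Relation.Binary.PropositionalEquality

  TwoValued : ℤ → ℤ → Set
  TwoValued c v = v ≡ c ⊎ v ≡ c + + 1

  two-valued-≥ : ∀ {c v} → TwoValued c v → c ≤ v
  two-valued-≥ (inj₁ refl) = ℤP.≤-refl
  two-valued-≥ {c} (inj₂ refl) = ℤP.i≤i+j c (+ 1)

  two-valued-≤ : ∀ {c v} → TwoValued c v → v ≤ c + + 1
  two-valued-≤ {c} (inj₁ refl) = ℤP.i≤i+j c (+ 1)
  two-valued-≤ (inj₂ refl) = ℤP.≤-refl

  two-valued-between : ∀ {c v} → c ≤ v → v ≤ c + + 1 → TwoValued c v
  two-valued-between {c} {v} c≤v v≤c+1 with ℤP.<-cmp c v
  ... | tri≈ _ c≡v _ = inj₁ (sym c≡v)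
  ... | tri> _ _ v<c = ⊥-elim (ℤP.<⇒≱ v<c c≤v)
  ... | tri< c<v _ _ =
    inj₂ (ℤP.≤-antisym v≤c+1 (subst (_≤ v) (ℤP.+-comm (+ 1) c) (ℤP.i<j⇒suc[i]≤j c<v)))

  minus-plus : ∀ x y → x ≡ (x - y) + y
  minus-plus x y = solve (x ∷ y ∷ [])

  plus-minus : ∀ x y → x ≡ y + (x - y)
  plus-minus x y = solve (x ∷ y ∷ [])

  ≤-differences : ∀ a b c d → a + b ≤ c + d → a - c ≤ d - b
  ≤-differences a b c d le = begin
    a - c                ≡⟨ solve (a ∷ b ∷ c ∷ []) ⟩
    (a + b) + (- c - b)  ≤⟨ ℤP.+-monoˡ-≤ (- c - b) le ⟩
    (c + d) + (- c - b)  ≡⟨ solve (b ∷ c ∷ d ∷ []) ⟩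
    d - b                ∎
    where open ℤP.≤-Reasoning

  octahedron-transfer : ∀ {F₁ F₂ F₃ F₄ F₅ F₆ : ℤ} (G₁ G₂ G₃ G₄ G₅ G₆ k : ℤ) →
    F₁ + F₂ ≡ (F₃ + F₄) ⊔ (F₅ + F₆) → G₁ + G₂ ≡ (G₃ + G₄) ⊔ (G₅ + G₆) →
    F₂ ≡ G₂ + k → F₃ ≡ G₃ + k → F₄ ≡ G₄ + k → F₅ ≡ G₅ + k → F₆ ≡ G₆ + k →
    F₁ ≡ G₁ + k
  octahedron-transfer {F₁} G₁ G₂ G₃ G₄ G₅ G₆ k octF octG refl refl refl refl refl =
    ∙-cancelʳ (G₂ + k) F₁ (G₁ + k) (begin
      F₁ + (G₂ + k)                                  ≡⟨ octF ⟩
      ((G₃ + k) + (G₄ + k)) ⊔ ((G₅ + k) + (G₆ + k))  ≡⟨ cong₂ _⊔_ (solve (G₃ ∷ G₄ ∷ k ∷ []))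
                                                                  (solve (G₅ ∷ G₆ ∷ k ∷ [])) ⟩
      ((G₃ + G₄) + (k + k)) ⊔ ((G₅ + G₆) + (k + k))  ≡⟨ ℤP.mono-≤-distrib-⊔ (ℤP.+-monoˡ-≤ (k + k))
                                                          (G₃ + G₄) (G₅ + G₆) ⟨
      ((G₃ + G₄) ⊔ (G₅ + G₆)) + (k + k)              ≡⟨ cong (_+ (k + k)) octG ⟨
      (G₁ + G₂) + (k + k)                            ≡⟨ solve (G₁ ∷ G₂ ∷ k ∷ []) ⟩
      (G₁ + k) + (G₂ + k)                            ∎)
    where open ≡-Reasoning

-- Staircases: functions on a lattice segment whose increments take two consecutive values
-- and decrease. Such a function is determined by its values at the two ends.
module Staircases where
  open IntegerFacts
  open import Data.Nat as ℕ using (ℕ; zero; suc)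
  open import Data.Nat.Properties as ℕP using ()
  open import Data.Integer as ℤ using (ℤ; +_; _+_; _-_; _≤_)
  open import Data.Integer.Properties as ℤP using ()
  open import Data.Integer.Tactic.RingSolver using (solve)
  open import Data.List using (_∷_; [])
  open import Data.Sum using (inj₁; inj₂)
  open import Data.Empty using (⊥; ⊥-elim)
  open import Relation.Binary.PropositionalEquality

  step : (ℕ → ℕ → ℤ) → ℕ → ℕ → ℤ
  step A α j = A α (suc j) - A (suc α) j

  record Staircase (c : ℤ) (L : ℕ) (A : ℕ → ℕ → ℤ) : Set where
    field
      two-valued : ∀ α j → suc (α ℕ.+ j) ≡ L → TwoValued c (step A α j)
      decreasing : ∀ α j → 2 ℕ.+ (α ℕ.+ j) ≡ L → step A α (suc j) ≤ step A (suc α) j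
  open Staircase public

  staircase-tail : ∀ {c L A} → Staircase c (suc L) A → Staircase c L (λ α j → A α (suc j))
  staircase-tail S = record
    { two-valued = λ α j e → two-valued S α (suc j) (cong suc (trans (ℕP.+-suc α j) e))
    ; decreasing = λ α j e → decreasing S α (suc j) (cong suc (trans (cong suc (ℕP.+-suc α j)) e))
    }

  staircase-shift : ∀ {c L A} κ → Staircase c L A → Staircase c L (λ α j → A α j + κ)
  staircase-shift {A = A} κ S = record
    { two-valued = λ α j e → subst (TwoValued _) (sym (step-shift α j)) (two-valued S α j e)
    ; decreasing = λ α j e → subst₂ _≤_ (sym (step-shift α (suc j))) (sym (step-shift (suc α) j))
                                       (decreasing S α j e)
    }
    where
      cancel-shift : ∀ a b → (a + κ) - (b + κ) ≡ a - b
      cancel-shift a b = solve (a ∷ b ∷ κ ∷ [])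
      step-shift : ∀ α j → step (λ a b → A a b + κ) α j ≡ step A α j
      step-shift α j = cancel-shift (A α (suc j)) (A (suc α) j)

  step-≤-first : ∀ {c L B} → Staircase c (suc L) B →
                 ∀ α j → suc (α ℕ.+ j) ≡ suc L → step B α j ≤ step B L 0
  step-≤-first {B = B} S α zero e =
    ℤP.≤-reflexive (cong (λ a → step B a 0) (trans (sym (ℕP.+-identityʳ α)) (ℕP.suc-injective e)))
  step-≤-first S α (suc j) e =
    ℤP.≤-trans (decreasing S α j (trans (sym (cong suc (ℕP.+-suc α j))) e))
               (step-≤-first S (suc α) j (trans (sym (cong suc (ℕP.+-suc α j))) e))

  rising : ∀ {L} (D : ℕ → ℕ → ℤ) → (∀ α j → suc (α ℕ.+ j) ≡ L → + 0 ≤ step D α j) →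
           ∀ α j → α ℕ.+ j ≡ L → D L 0 ≤ D α j
  rising D up α zero e =
    ℤP.≤-reflexive (cong (λ a → D a 0) (sym (trans (sym (ℕP.+-identityʳ α)) e)))
  rising {L} D up α (suc j) e =
    ℤP.≤-trans (rising D up (suc α) j e′) (ℤP.0≤i-j⇒j≤i (up α j e′))
    where
      e′ : suc α ℕ.+ j ≡ L
      e′ = trans (sym (ℕP.+-suc α j)) e

  -- Two staircases with equal endpoints cannot start with different increments: if A starts
  -- with c + 1 and B with c, then A − B rises weakly along the rest of the segment, from 1 to 0.
  no-first-step-mismatch : ∀ {c L A B} → Staircase c (suc L) A → Staircase c (suc L) B →
    step A L 0 ≡ c + + 1 → step B L 0 ≡ c →
    A (suc L) 0 ≡ B (suc L) 0 → A 0 (suc L) ≡ B 0 (suc L) → ⊥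
  no-first-step-mismatch {c} {L} {A} {B} SA SB firstA firstB e₀ eL =
    ℤP.<⇒≱ (ℤ.+<+ (ℕ.s≤s ℕ.z≤n))
      (subst₂ _≤_ D-after-first D-at-end (rising (λ α j → D α (suc j)) D-rises 0 L refl))
    where
      D : ℕ → ℕ → ℤ
      D α j = A α j - B α j
      step-D : ∀ α j → step D α j ≡ step A α j - step B α j
      step-D α j = swap-differences (A α (suc j)) (A (suc α) j) (B α (suc j)) (B (suc α) j)
        where
          swap-differences : ∀ a₁ a₀ b₁ b₀ →
                             (a₁ - b₁) - (a₀ - b₀) ≡ (a₁ - a₀) - (b₁ - b₀)
          swap-differences a₁ a₀ b₁ b₀ = solve (a₁ ∷ a₀ ∷ b₁ ∷ b₀ ∷ [])
      D-rises : ∀ α j → suc (α ℕ.+ j) ≡ L → + 0 ≤ step D α (suc j)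
      D-rises α j e = subst (+ 0 ≤_) (sym (step-D α (suc j))) (ℤP.i≤j⇒0≤j-i (begin
        step B α (suc j) ≤⟨ step-≤-first SB α (suc j) on-segment ⟩
        step B L 0       ≡⟨ firstB ⟩
        c                ≤⟨ two-valued-≥ (two-valued SA α (suc j) on-segment) ⟩
        step A α (suc j) ∎))
        where
          open ℤP.≤-Reasoning
          on-segment : suc (α ℕ.+ suc j) ≡ suc L
          on-segment = cong suc (trans (ℕP.+-suc α j) e)
      D-at-end : D 0 (suc L) ≡ + 0
      D-at-end = trans (cong (_- B 0 (suc L)) eL) (ℤP.+-inverseʳ (B 0 (suc L)))
      D-after-first : D L 1 ≡ + 1
      D-after-first = begin
        D L 1                                       ≡⟨ cong₂ _-_ (from-step A firstA) (from-step B firstB) ⟩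
        (c + + 1 + A (suc L) 0) - (c + B (suc L) 0) ≡⟨ cong (λ b → (c + + 1 + A (suc L) 0) - (c + b)) e₀ ⟨
        (c + + 1 + A (suc L) 0) - (c + A (suc L) 0) ≡⟨ one-apart c (A (suc L) 0) ⟩
        + 1                                         ∎
        where
          open ≡-Reasoning
          from-step : ∀ X {s} → step X L 0 ≡ s → X L 1 ≡ s + X (suc L) 0
          from-step X refl = minus-plus (X L 1) (X (suc L) 0)
          one-apart : ∀ c a → (c + + 1 + a) - (c + a) ≡ + 1
          one-apart c a = solve (c ∷ a ∷ [])

  first-step-agrees : ∀ {c L A B} → Staircase c (suc L) A → Staircase c (suc L) B →
    A (suc L) 0 ≡ B (suc L) 0 → A 0 (suc L) ≡ B 0 (suc L) → A L 1 ≡ B L 1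
  first-step-agrees {c} {L} {A} {B} SA SB e₀ eL =
    agree (two-valued SA L 0 first) (two-valued SB L 0 first)
    where
      first : suc (L ℕ.+ 0) ≡ suc L
      first = cong suc (ℕP.+-identityʳ L)
      same-step : step A L 0 ≡ step B L 0 → A L 1 ≡ B L 1
      same-step sA≡sB = begin
        A L 1                     ≡⟨ minus-plus (A L 1) (A (suc L) 0) ⟩
        step A L 0 + A (suc L) 0  ≡⟨ cong₂ _+_ sA≡sB e₀ ⟩
        step B L 0 + B (suc L) 0  ≡⟨ minus-plus (B L 1) (B (suc L) 0) ⟨
        B L 1                     ∎
        where open ≡-Reasoning
      agree : TwoValued c (step A L 0) → TwoValued c (step B L 0) → A L 1 ≡ B L 1
      agree (inj₁ sA) (inj₁ sB) = same-step (trans sA (sym sB))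
      agree (inj₂ sA) (inj₂ sB) = same-step (trans sA (sym sB))
      agree (inj₂ sA) (inj₁ sB) = ⊥-elim (no-first-step-mismatch SA SB sA sB e₀ eL)
      agree (inj₁ sA) (inj₂ sB) = ⊥-elim (no-first-step-mismatch SB SA sB sA (sym e₀) (sym eL))

  staircase-unique : ∀ {c} L {A B} → Staircase c L A → Staircase c L B →
    A L 0 ≡ B L 0 → A 0 L ≡ B 0 L → ∀ α j → α ℕ.+ j ≡ L → A α j ≡ B α j
  staircase-unique zero SA SB e₀ eL zero zero refl = e₀
  staircase-unique (suc L) {A} {B} SA SB e₀ eL α zero e =
    subst (λ a → A a 0 ≡ B a 0) (sym (trans (sym (ℕP.+-identityʳ α)) e)) e₀
  staircase-unique (suc L) SA SB e₀ eL α (suc j) e =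
    staircase-unique L (staircase-tail SA) (staircase-tail SB)
      (first-step-agrees SA SB e₀ eL) eL α j (ℕP.suc-injective (trans (sym (ℕP.+-suc α j)) e))

-- Minuscule weights are "two-step": entries in {c, c + 1}, weakly decreasing.
module StepWeights where
  open IntegerFacts
  open import Data.Nat as ℕ using (ℕ; suc; _∸_)
  open import Data.Nat.Properties as ℕP using ()
  open import Data.Integer as ℤ using (ℤ; +_; -_; -[1+_]; _≤_)
  open import Data.Integer.Properties as ℤP using ()
  open import Data.Fin using (Fin; toℕ)
  open import Data.Vec using (Vec; lookup)
  open import Data.Vec.Properties using (lookup∘tabulate)
  open import Data.Bool using (true; false; if_then_else_; T)
  open import Data.Unit using (tt)
  open import Data.Product using (_,_; ∃)
  open import Data.Sum using (inj₁; inj₂)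
  open import Data.Empty using (⊥-elim)
  open import Relation.Binary.PropositionalEquality

  record StepWeight {m : ℕ} (c : ℤ) (w : Vec ℤ m) : Set where
    field
      entries : ∀ t → TwoValued c (lookup w t)
      sorted  : ∀ (t t′ : Fin m) → suc (toℕ t) ≡ toℕ t′ → lookup w t′ ≤ lookup w t
  open StepWeight public

  -- ω_i = (1^i, 0^(m−i)) takes values in {0, 1}; ω_i* = (0^(m−i), (−1)^i) in {−1, 0}.
  minuscule-step-weight : ∀ m {w} → Minuscule m w → ∃ λ c → StepWeight c w
  minuscule-step-weight m (i , _ , _ , inj₁ refl) =
    + 0 , record { entries = entries′ ; sorted = sorted′ }
    where
      ωᵢ : Fin m → ℤ
      ωᵢ t = if toℕ t ℕ.<ᵇ i then + 1 else + 0
      entries′ : ∀ t → TwoValued (+ 0) (lookup (ω m i) t)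
      entries′ t rewrite lookup∘tabulate ωᵢ t with toℕ t ℕ.<ᵇ i
      ... | true = inj₂ refl
      ... | false = inj₁ refl
      sorted′ : ∀ t t′ → suc (toℕ t) ≡ toℕ t′ → lookup (ω m i) t′ ≤ lookup (ω m i) t
      sorted′ t t′ e rewrite lookup∘tabulate ωᵢ t | lookup∘tabulate ωᵢ t′
        with toℕ t ℕ.<ᵇ i in t<i | toℕ t′ ℕ.<ᵇ i in t′<i
      ... | true | true = ℤP.≤-refl
      ... | true | false = ℤ.+≤+ ℕ.z≤n
      ... | false | true = ⊥-elim (subst T t<i (ℕP.<⇒<ᵇ
            (ℕP.<-trans (ℕP.≤-reflexive e) (ℕP.<ᵇ⇒< (toℕ t′) i (subst T (sym t′<i) tt)))))
      ... | false | false = ℤP.≤-refl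
  minuscule-step-weight m (i , _ , _ , inj₂ refl) =
    -[1+ 0 ] , record { entries = entries′ ; sorted = sorted′ }
    where
      ωᵢ* : Fin m → ℤ
      ωᵢ* t = if (m ∸ i) ℕ.≤ᵇ toℕ t then - (+ 1) else + 0
      entries′ : ∀ t → TwoValued -[1+ 0 ] (lookup (ω* m i) t)
      entries′ t rewrite lookup∘tabulate ωᵢ* t with (m ∸ i) ℕ.≤ᵇ toℕ t
      ... | true = inj₁ refl
      ... | false = inj₂ refl
      sorted′ : ∀ t t′ → suc (toℕ t) ≡ toℕ t′ → lookup (ω* m i) t′ ≤ lookup (ω* m i) t
      sorted′ t t′ e rewrite lookup∘tabulate ωᵢ* t | lookup∘tabulate ωᵢ* t′
        with (m ∸ i) ℕ.≤ᵇ toℕ t in i≤t | (m ∸ i) ℕ.≤ᵇ toℕ t′ in i≤t′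
      ... | true | true = ℤP.≤-refl
      ... | false | true = ℤ.-≤+
      ... | false | false = ℤP.≤-refl
      ... | true | false = ⊥-elim (subst T i≤t′ (ℕP.≤⇒≤ᵇ
            (ℕP.≤-trans (ℕP.≤ᵇ⇒≤ (m ∸ i) (toℕ t) (subst T (sym i≤t) tt))
                        (ℕP.≤-trans (ℕP.n≤1+n _) (ℕP.≤-reflexive e)))))

module Agreement {n : ℕ} (m : ℕ) (f g : Vec ℕ n → ℤ) (κ : ℤ) where
  open Points
  open IntegerFacts
  open Staircases
  open StepWeights
  open import Data.Nat as ℕ using (zero; suc; _∸_)
  open import Data.Nat.Properties as ℕP using ()
  open import Data.Integer as ℤ using (_+_; _-_)
  open import Data.Integer.Properties as ℤP using ()
  open import Data.Integer.Tactic.RingSolver using (solve)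
  open import Data.List using (_∷_; [])
  open import Data.Fin as Fin using (fromℕ<)
  open import Data.Fin.Properties as FinP using (_≟_; toℕ-fromℕ<)
  open import Data.Vec using (sum; lookup)
  open import Data.Vec.Properties using (lookup∘tabulate)
  open import Data.Product using (_×_; _,_; proj₁; proj₂)
  open import Data.Sum using (_⊎_; inj₁; inj₂)
  open import Data.Empty using (⊥-elim)
  open import Relation.Binary.PropositionalEquality
  open import Relation.Nullary using (¬_; does; yes; no)
  open import Relation.Nullary.Decidable using (_×-dec_; _⊎-dec_)
  open import Relation.Unary using (Decidable)
  open import Data.Bool using (if_then_else_)

  Agree : Vec ℕ n → Set
  Agree x = f x ≡ g x + κ

  AgreeOn : (Fin n → Set) → Set
  AgreeOn P = ∀ x → sum x ≡ m → Supp P x → Agree x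

  segment-point : ∀ {u v} (w : Vec ℕ n) → u ≢ v → sum w ≡ m →
                  Supp (λ d → d ≡ u ⊎ d ≡ v) w → w ≡ edgePt m u v (lookup w v)
  segment-point {u} {v} w u≢v sw s = vec-ext λ d → trans (coordinate d) (sym (lookup∘tabulate _ d))
    where
      wᵤ≡ : lookup w u ≡ m ∸ lookup w v
      wᵤ≡ = trans (sym (ℕP.m+n∸n≡m (lookup w u) (lookup w v)))
                  (cong (_∸ lookup w v) (trans (sym (sum-pair w u≢v s)) sw))
      coordinate : ∀ d → lookup w d ≡ (if does (d ≟ u) then m ∸ lookup w v else 0)
                                        ℕ.+ (if does (d ≟ v) then lookup w v else 0)
      coordinate d with d ≟ u | d ≟ v
      ... | yes refl | yes refl = ⊥-elim (u≢v refl)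
      ... | yes refl | no _ = trans wᵤ≡ (sym (ℕP.+-identityʳ _))
      ... | no _ | yes refl = refl
      ... | no d≢u | no d≢v = s d λ { (inj₁ e) → d≢u e ; (inj₂ e) → d≢v e }

  weight-entry : ∀ (h : Vec ℕ n → ℤ) u v {t} (t<m : t ℕ.< m) →
    lookup (weight m h u v) (fromℕ< t<m) ≡ h (edgePt m u v (suc t)) - h (edgePt m u v t)
  weight-entry h u v t<m = trans (lookup∘tabulate _ (fromℕ< t<m))
    (cong (λ s → h (edgePt m u v (suc s)) - h (edgePt m u v s)) (toℕ-fromℕ< t<m))

  segment-agrees : ∀ {u v} → u ≢ v → weight m f u v ≡ weight m g u v → Agree (vertex m u) →
                   AgreeOn (λ d → d ≡ u ⊎ d ≡ v)
  segment-agrees {u} {v} u≢v same-weight at-u w sw s =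
    subst Agree (sym (segment-point w u≢v sw s))
      (along (lookup w v) (subst (lookup w v ℕ.≤_) (trans (sym (sum-pair w u≢v s)) sw) (ℕP.m≤n+m _ _)))
    where
      start : vertex m u ≡ edgePt m u v 0
      start = trans (segment-point (vertex m u) u≢v (sum-vertex m u) (supp-vertex m (inj₁ refl)))
                    (cong (edgePt m u v) (supp-vertex {P = _≡ u} m refl v λ v≡u → u≢v (sym v≡u)))
      along : ∀ t → t ℕ.≤ m → Agree (edgePt m u v t)
      along zero _ = subst Agree start at-u
      along (suc t) t<m = begin
        f (edgePt m u v (suc t))                                ≡⟨ minus-plus _ _ ⟩
        (f (edgePt m u v (suc t)) - f (edgePt m u v t)) + f (edgePt m u v t)
          ≡⟨ cong₂ _+_ same-increment (along t (ℕP.<⇒≤ t<m)) ⟩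
        (g (edgePt m u v (suc t)) - g (edgePt m u v t)) + (g (edgePt m u v t) + κ)
          ≡⟨ regroup (g (edgePt m u v (suc t))) (g (edgePt m u v t)) ⟩
        g (edgePt m u v (suc t)) + κ                            ∎
        where
          open ≡-Reasoning
          same-increment : f (edgePt m u v (suc t)) - f (edgePt m u v t)
                         ≡ g (edgePt m u v (suc t)) - g (edgePt m u v t)
          same-increment = trans (sym (weight-entry f u v t<m))
            (trans (cong (λ w → lookup w (fromℕ< t<m)) same-weight) (weight-entry g u v t<m))
          regroup : ∀ a b → (a - b) + (b + κ) ≡ a + κ
          regroup a b = solve (a ∷ b ∷ κ ∷ [])

  Rhombus : (Vec ℕ n → ℤ) → Fin n → Fin n → Fin n → Vec ℕ n → Set
  Rhombus h v u w p =
    h (addE v (addE v p)) + h (addE u (addE w p)) ℤ.≤ h (addE v (addE u p)) + h (addE v (addE w p))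

  RhombiAt : (Vec ℕ n → ℤ) → (Fin n → Set) → Fin n → Fin n → Fin n → Set
  RhombiAt h T v u w = ∀ p → sum p ℕ.+ 2 ≡ m → Supp T p → Rhombus h v u w p

  Triangle : Fin n → Fin n → Fin n → Fin n → Set
  Triangle a c b d = d ≡ a ⊎ d ≡ c ⊎ d ≡ b

  face-rhombi : ∀ {h} → FaceHive m h → ∀ {a b c} → a Fin.< b → b Fin.< c →
    ∀ p → sum p ℕ.+ 2 ≡ m → Supp (Triangle a b c) p →
    Rhombus h a b c p × Rhombus h b a c p × Rhombus h c a b p
  face-rhombi {h} fh {a} {b} {c} a<b b<c p e s with fh a b c a<b b<c p on-face e
    where
      on-face : SupportedOn a b c p
      on-face d d≢a d≢b d≢c = s d λ where
        (inj₁ d≡a) → d≢a d≡a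
        (inj₂ (inj₁ d≡b)) → d≢b d≡b
        (inj₂ (inj₂ d≡c)) → d≢c d≡c
  ... | around-a , around-c , around-b =
    subst (h (addE a (addE a p)) + h (addE b (addE c p)) ℤ.≤_)
      (ℤP.+-comm (h (addE a (addE c p))) _) around-a ,
    subst (h (addE b (addE b p)) + h (addE a (addE c p)) ℤ.≤_)
      (trans (ℤP.+-comm (h (addE b (addE c p))) _)
             (cong (λ q → h q + h (addE b (addE c p))) (addE-comm a b p)))
      around-b ,
    subst₂ ℤ._≤_ (ℤP.+-comm (h (addE a (addE b p))) _)
      (trans (ℤP.+-comm (h (addE b (addE c p))) _)
             (cong₂ (λ q r → h q + h r) (addE-comm a c p) (addE-comm b c p)))
      around-c

  rhombus-sym : ∀ h v u w p → Rhombus h v u w p → Rhombus h v w u p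
  rhombus-sym h v u w p r = subst₂ ℤ._≤_
    (cong (λ q → h (addE v (addE v p)) + h q) (addE-comm u w p))
    (ℤP.+-comm (h (addE v (addE u p))) (h (addE v (addE w p)))) r

  -- In coordinates tri α j k = α e_x + j e_y + k e_z, the rows
  -- k = const are segments parallel to [P_x, P_y]. The bottom row k = 0 has the weight of
  -- P_x → P_y as increments, so it is a staircase when that weight is two-step; the rhombus
  -- inequalities around x and y squeeze each row between two neighbours of the row below,
  -- so every row is a staircase. A staircase is fixed by its ends, which lie on [P_x, P_z]
  -- and [P_y, P_z]: hence f and g agree on the whole face once they agree on these two sides.
  module Face {x y z : Fin n} (x≢y : x ≢ y) (y≢z : y ≢ z) (x≢z : x ≢ z)
              (T : Fin n → Set) (Tx : T x) (Ty : T y) (Tz : T z)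
              (T⊆xyz : ∀ d → T d → d ≡ x ⊎ d ≡ y ⊎ d ≡ z) where

    tri : ℕ → ℕ → ℕ → Vec ℕ n
    tri α j k = addEs α x (addEs j y (addEs k z zeros))

    tri-y : ∀ α j k → addE y (tri α j k) ≡ tri α (suc j) k
    tri-y α j k = addE-addEs y x α _

    tri-z : ∀ α j k → addE z (tri α j k) ≡ tri α j (suc k)
    tri-z α j k = trans (addE-addEs z x α _) (cong (addEs α x) (addE-addEs z y j _))

    sum-tri : ∀ α j k → sum (tri α j k) ≡ α ℕ.+ j ℕ.+ k
    sum-tri α j k = begin
      sum (tri α j k)                                  ≡⟨ sum-addEs α x _ ⟩
      α ℕ.+ sum (addEs j y (addEs k z zeros))          ≡⟨ cong (α ℕ.+_) (sum-addEs j y _) ⟩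
      α ℕ.+ (j ℕ.+ sum (addEs k z (zeros {n})))        ≡⟨ cong (λ s → α ℕ.+ (j ℕ.+ s)) (sum-vertex k z) ⟩
      α ℕ.+ (j ℕ.+ k)                                  ≡⟨ ℕP.+-assoc α j k ⟨
      α ℕ.+ j ℕ.+ k                                    ∎
      where open ≡-Reasoning

    supp-tri : ∀ {P : Fin n → Set} α j k → (α ≢ 0 → P x) → (j ≢ 0 → P y) → (k ≢ 0 → P z) →
               Supp P (tri α j k)
    supp-tri α j k Px Py Pz =
      supp-addEs α Px (supp-addEs j Py (supp-addEs k Pz (λ d _ → lookup-zeros d)))

    lookup-tri-x : ∀ α j k → lookup (tri α j k) x ≡ α
    lookup-tri-x α j k = trans (lookup-addEs α x _)
      (trans (cong (α ℕ.+_) (supp-tri {P = λ d → d ≢ x} 0 j k (λ h → ⊥-elim (h refl))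
                               (λ _ y≡x → x≢y (sym y≡x)) (λ _ z≡x → x≢z (sym z≡x)) x (λ h → h refl)))
             (ℕP.+-identityʳ α))

    lookup-tri-y : ∀ α j k → lookup (tri α j k) y ≡ j
    lookup-tri-y α j k = trans (lookup-addEs′ α _ (λ y≡x → x≢y (sym y≡x))) (trans (lookup-addEs j y _)
      (trans (cong (j ℕ.+_) (supp-tri {P = λ d → d ≢ y} 0 0 k (λ h → ⊥-elim (h refl))
                               (λ h → ⊥-elim (h refl)) (λ _ z≡y → y≢z (sym z≡y)) y (λ h → h refl)))
             (ℕP.+-identityʳ j)))

    lookup-tri-z : ∀ α j k → lookup (tri α j k) z ≡ k
    lookup-tri-z α j k = trans (lookup-addEs′ α _ (λ z≡x → x≢z (sym z≡x)))
      (trans (lookup-addEs′ j _ (λ z≡y → y≢z (sym z≡y)))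
        (lookup-vertex k z))

    tri-coordinates : ∀ v → Supp T v → v ≡ tri (lookup v x) (lookup v y) (lookup v z)
    tri-coordinates v s = vec-ext coordinate
      where
        coords : Vec ℕ n
        coords = tri (lookup v x) (lookup v y) (lookup v z)
        coordinate : ∀ d → lookup v d ≡ lookup coords d
        coordinate d with d ≟ x | d ≟ y | d ≟ z
        ... | yes refl | _ | _ = sym (lookup-tri-x (lookup v x) (lookup v y) (lookup v z))
        ... | no _ | yes refl | _ = sym (lookup-tri-y (lookup v x) (lookup v y) (lookup v z))
        ... | no _ | no _ | yes refl = sym (lookup-tri-z (lookup v x) (lookup v y) (lookup v z))
        ... | no d≢x | no d≢y | no d≢z =
          trans (s d ¬Td) (sym (supp-tri (lookup v x) (lookup v y) (lookup v z)
                                         (λ _ → Tx) (λ _ → Ty) (λ _ → Tz) d ¬Td))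
          where
            ¬Td : ¬ T d
            ¬Td Td with T⊆xyz d Td
            ... | inj₁ e = d≢x e
            ... | inj₂ (inj₁ e) = d≢y e
            ... | inj₂ (inj₂ e) = d≢z e

    tri-bottom : ∀ α j → α ℕ.+ j ℕ.+ 0 ≡ m → tri α j 0 ≡ edgePt m x y j
    tri-bottom α j e = trans (segment-point (tri α j 0) x≢y (trans (sum-tri α j 0) e)
                               (supp-tri α j 0 (λ _ → inj₁ refl) (λ _ → inj₂ refl) (λ h → ⊥-elim (h refl))))
                             (cong (edgePt m x y) (lookup-tri-y α j 0))

    shift-y : ∀ α j k → α ℕ.+ suc j ℕ.+ k ≡ suc (α ℕ.+ j ℕ.+ k)
    shift-y α j k = cong (ℕ._+ k) (ℕP.+-suc α j)

    row : (Vec ℕ n → ℤ) → ℕ → ℕ → ℕ → ℤ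
    row h k α j = h (tri α j k)

    record RowStaircase (c : ℤ) (h : Vec ℕ n → ℤ) (k : ℕ) : Set where
      field
        row-two-valued : ∀ α j → suc (α ℕ.+ j ℕ.+ k) ≡ m → TwoValued c (step (row h k) α j)
        row-decreasing : ∀ α j → 2 ℕ.+ (α ℕ.+ j ℕ.+ k) ≡ m →
                     step (row h k) α (suc j) ℤ.≤ step (row h k) (suc α) j

    row-staircase : ∀ {c h k} → RowStaircase c h k → ∀ L → L ℕ.+ k ≡ m → Staircase c L (row h k)
    row-staircase {k = k} R L e = record
      { two-valued = λ α j e′ → RowStaircase.row-two-valued R α j (trans (cong (ℕ._+ k) e′) e)
      ; decreasing = λ α j e′ → RowStaircase.row-decreasing R α j (trans (cong (ℕ._+ k) e′) e)
      }

    module Rows (h : Vec ℕ n → ℤ) (rhombi-x : RhombiAt h T x y z) (rhombi-y : RhombiAt h T y x z) where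

      base : ∀ α j k → 2 ℕ.+ (α ℕ.+ j ℕ.+ k) ≡ m → sum (tri α j k) ℕ.+ 2 ≡ m
      base α j k e = trans (cong (ℕ._+ 2) (sum-tri α j k)) (trans (ℕP.+-comm _ 2) e)

      supp-base : ∀ α j k → Supp T (tri α j k)
      supp-base α j k = supp-tri α j k (λ _ → Tx) (λ _ → Ty) (λ _ → Tz)

      squeeze-above : ∀ α j k → 2 ℕ.+ (α ℕ.+ j ℕ.+ k) ≡ m →
                      step (row h (suc k)) α j ℤ.≤ step (row h k) (suc α) j
      squeeze-above α j k e = ≤-differences a b c d rhombus
        where
          a b c d : ℤ
          a = h (tri α (suc j) (suc k))
          b = h (tri (2 ℕ.+ α) j k)
          c = h (tri (suc α) j (suc k))
          d = h (tri (suc α) (suc j) k)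
          rhombus : a + b ℤ.≤ c + d
          rhombus = subst₂ ℤ._≤_
            (trans (ℤP.+-comm b _) (cong (λ q → h q + b)
              (trans (cong (addE y) (tri-z α j k)) (tri-y α j (suc k)))))
            (trans (ℤP.+-comm (h (addE x (addE y (tri α j k)))) _)
              (cong₂ (λ q r → h (addE x q) + h (addE x r)) (tri-z α j k) (tri-y α j k)))
            (rhombi-x (tri α j k) (base α j k e) (supp-base α j k))

      squeeze-below : ∀ α j k → 2 ℕ.+ (α ℕ.+ j ℕ.+ k) ≡ m →
                      step (row h k) α (suc j) ℤ.≤ step (row h (suc k)) α j
      squeeze-below α j k e = ≤-differences a b c d rhombus
        where
          a b c d : ℤ
          a = h (tri α (2 ℕ.+ j) k)
          b = h (tri (suc α) j (suc k))
          c = h (tri (suc α) (suc j) k)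
          d = h (tri α (suc j) (suc k))
          rhombus : a + b ℤ.≤ c + d
          rhombus = subst₂ ℤ._≤_
            (cong₂ (λ q r → h q + h (addE x r))
              (trans (cong (addE y) (tri-y α j k)) (tri-y α (suc j) k)) (tri-z α j k))
            (cong₂ (λ q r → h q + h r)
              (tri-y (suc α) j k) (trans (cong (addE y) (tri-z α j k)) (tri-y α j (suc k))))
            (rhombi-y (tri α j k) (base α j k e) (supp-base α j k))

      next-row : ∀ {c} k → RowStaircase c h k → RowStaircase c h (suc k)
      next-row {c} k R = record { row-two-valued = two-valued′ ; row-decreasing = decreasing′ }
        where
          open RowStaircase R
          two-valued′ : ∀ α j → suc (α ℕ.+ j ℕ.+ suc k) ≡ m →
                        TwoValued c (step (row h (suc k)) α j)
          two-valued′ α j e = two-valued-between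
            (ℤP.≤-trans (two-valued-≥ (row-two-valued α (suc j) (trans (cong suc (shift-y α j k)) e′)))
                        (squeeze-below α j k e′))
            (ℤP.≤-trans (squeeze-above α j k e′) (two-valued-≤ (row-two-valued (suc α) j e′)))
            where
              e′ : 2 ℕ.+ (α ℕ.+ j ℕ.+ k) ≡ m
              e′ = trans (cong suc (sym (ℕP.+-suc (α ℕ.+ j) k))) e
          decreasing′ : ∀ α j → 2 ℕ.+ (α ℕ.+ j ℕ.+ suc k) ≡ m →
                        step (row h (suc k)) α (suc j) ℤ.≤ step (row h (suc k)) (suc α) j
          decreasing′ α j e = ℤP.≤-trans
            (squeeze-above α (suc j) k (trans (cong (2 ℕ.+_) (shift-y α j k)) e′))
            (squeeze-below (suc α) j k e′)
            where
              e′ : 3 ℕ.+ (α ℕ.+ j ℕ.+ k) ≡ m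
              e′ = trans (cong (2 ℕ.+_) (sym (ℕP.+-suc (α ℕ.+ j) k))) e

      bottom-row : ∀ {c} → StepWeight c (weight m h x y) → RowStaircase c h 0
      bottom-row {c} W = record
        { row-two-valued = λ α j e → subst (TwoValued c) (sym (bottom-step α j e)) (entries W _)
        ; row-decreasing = λ α j e → subst₂ ℤ._≤_ (sym (bottom-step α (suc j) (shift-y′ α j e)))
            (sym (bottom-step (suc α) j e))
            (sorted W _ _ (trans (cong suc (toℕ-fromℕ< _)) (sym (toℕ-fromℕ< _))))
        }
        where
          j<m : ∀ α j → suc (α ℕ.+ j ℕ.+ 0) ≡ m → j ℕ.< m
          j<m α j e = ℕP.≤-trans (ℕ.s≤s (ℕP.≤-trans (ℕP.m≤n+m j α) (ℕP.m≤m+n (α ℕ.+ j) 0)))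
                                 (ℕP.≤-reflexive e)
          shift-y′ : ∀ α j → 2 ℕ.+ (α ℕ.+ j ℕ.+ 0) ≡ m → suc (α ℕ.+ suc j ℕ.+ 0) ≡ m
          shift-y′ α j e = trans (cong suc (shift-y α j 0)) e
          bottom-step : ∀ α j (e : suc (α ℕ.+ j ℕ.+ 0) ≡ m) →
                        step (row h 0) α j ≡ lookup (weight m h x y) (fromℕ< (j<m α j e))
          bottom-step α j e = trans
            (cong₂ (λ p q → h p - h q) (tri-bottom α (suc j) (trans (shift-y α j 0) e))
                                       (tri-bottom (suc α) j e))
            (sym (weight-entry h x y (j<m α j e)))

      rows : ∀ {c} → StepWeight c (weight m h x y) → ∀ k → RowStaircase c h k
      rows W zero = bottom-row W
      rows W (suc k) = next-row k (rows W k)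

    face-agrees : ∀ {c} → RhombiAt f T x y z → RhombiAt f T y x z →
                  RhombiAt g T x y z → RhombiAt g T y x z →
                  StepWeight c (weight m f x y) → StepWeight c (weight m g x y) →
                  AgreeOn (λ d → d ≡ x ⊎ d ≡ z) → AgreeOn (λ d → d ≡ y ⊎ d ≡ z) → AgreeOn T
    face-agrees rfx rfy rgx rgy Wf Wg agree-xz agree-yz v sv s =
      subst Agree (sym v≡tri)
        (on-row α j k (trans (sym (sum-tri α j k)) (trans (cong sum (sym v≡tri)) sv)))
      where
        α j k : ℕ
        α = lookup v x
        j = lookup v y
        k = lookup v z
        v≡tri : v ≡ tri α j k
        v≡tri = tri-coordinates v s
        on-row : ∀ α j k → α ℕ.+ j ℕ.+ k ≡ m → Agree (tri α j k)
        on-row α j k e = staircase-unique (α ℕ.+ j)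
          (row-staircase (Rows.rows f rfx rfy Wf k) (α ℕ.+ j) e)
          (staircase-shift κ (row-staircase (Rows.rows g rgx rgy Wg k) (α ℕ.+ j) e))
          (agree-xz _ (trans (sum-tri (α ℕ.+ j) 0 k) (trans (cong (ℕ._+ k) (ℕP.+-identityʳ _)) e))
                      (supp-tri (α ℕ.+ j) 0 k (λ _ → inj₁ refl) (λ h → ⊥-elim (h refl)) (λ _ → inj₂ refl)))
          (agree-yz _ (trans (sum-tri 0 (α ℕ.+ j) k) e)
                      (supp-tri 0 (α ℕ.+ j) k (λ h → ⊥-elim (h refl)) (λ _ → inj₁ refl) (λ _ → inj₂ refl)))
          α j refl

  Between : Fin n → Fin n → Fin n → Set
  Between a b d = a Fin.≤ d × d Fin.≤ b

  -- Gluing along the octahedron recurrence: agreement spreads from two adjacent regions of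
  -- Δ^n_m to their span, one octahedron at a time, by induction on the mass in the gap.
  module Gluing (octF : Octahedron m f) (octG : Octahedron m g) where

    octahedron-ac : ∀ i → sum i ℕ.+ 2 ≡ m → ∀ {a b c d} → a Fin.< b → b Fin.< c → c Fin.< d →
      Agree (addE a (addE b i)) → Agree (addE c (addE d i)) → Agree (addE a (addE d i)) →
      Agree (addE b (addE c i)) → Agree (addE b (addE d i)) → Agree (addE a (addE c i))
    octahedron-ac i e {a} {b} {c} {d} a<b b<c c<d ab cd ad bc bd =
      octahedron-transfer (g (addE a (addE c i))) (g (addE b (addE d i))) (g (addE a (addE b i)))
        (g (addE c (addE d i))) (g (addE a (addE d i))) (g (addE b (addE c i))) κ
        (octF i e a b c d a<b b<c c<d) (octG i e a b c d a<b b<c c<d) bd ab cd ad bc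

    octahedron-bd : ∀ i → sum i ℕ.+ 2 ≡ m → ∀ {a b c d} → a Fin.< b → b Fin.< c → c Fin.< d →
      Agree (addE a (addE b i)) → Agree (addE c (addE d i)) → Agree (addE a (addE d i)) →
      Agree (addE b (addE c i)) → Agree (addE a (addE c i)) → Agree (addE b (addE d i))
    octahedron-bd i e {a} {b} {c} {d} a<b b<c c<d ab cd ad bc ac =
      octahedron-transfer (g (addE b (addE d i))) (g (addE a (addE c i))) (g (addE a (addE b i)))
        (g (addE c (addE d i))) (g (addE a (addE d i))) (g (addE b (addE c i))) κ
        (trans (ℤP.+-comm (f (addE b (addE d i))) _) (octF i e a b c d a<b b<c c<d))
        (trans (ℤP.+-comm (g (addE b (addE d i))) _) (octG i e a b c d a<b b<c c<d)) ac ab cd ad bc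

    -- One induction step on the Q-mass over the points supported on T: if x = i + e_p + e_q
    -- with p, q ∈ Q, then each i + e_u + e_w with u, w ∈ T, not both in Q, has smaller mass.
    module Descent {T Q : Fin n → Set} (Q? : Decidable Q) {x i : Vec ℕ n} {p q : Fin n}
                   (x≡ : x ≡ addE p (addE q i)) (sx : sum x ≡ m) (tx : Supp T x) (Qp : Q p) (Qq : Q q)
                   (IH : ∀ y → mass Q? y ℕ.< mass Q? x → sum y ≡ m → Supp T y → Agree y) where

      base-sum : sum i ℕ.+ 2 ≡ m
      base-sum = trans (sym (sum-addE₂ p q i)) (trans (cong sum (sym x≡)) sx)

      descend : ∀ u w → T u → T w → ¬ Q u ⊎ ¬ Q w → Agree (addE u (addE w i))
      descend u w Tu Tw not-both = IH _ smaller
        (trans (sum-addE₂ u w i) base-sum)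
        (supp-addE {x = addE w i} Tu (supp-addE {x = i} Tw
          (supp-addE⁻ {a = q} {x = i} (supp-addE⁻ {a = p} {x = addE q i} (subst (Supp T) x≡ tx)))))
        where
          smaller : mass Q? (addE u (addE w i)) ℕ.< mass Q? x
          smaller = ℕP.<-≤-trans (ℕ.s≤s (mass-addE₂-≤ Q? i not-both)) (ℕP.≤-reflexive (sym (begin
            mass Q? x                          ≡⟨ cong (mass Q?) x≡ ⟩
            mass Q? (addE p (addE q i))        ≡⟨ mass-in Q? (addE q i) Qp ⟩
            suc (mass Q? (addE q i))           ≡⟨ cong suc (mass-in Q? i Qq) ⟩
            suc (suc (mass Q? i))              ∎)))
            where open ≡-Reasoning

    -- A point with mass both at b and strictly inside (a, c), at p say, is the top of the
    -- octahedron (a, p, c, b); its other five vertices carry less mass on Q = (a, c) ∪ {b}.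
    module Apex {a c b : Fin n} (a<c : a Fin.< c) (c<b : c Fin.< b) where

      T : Fin n → Set
      T d = Between a c d ⊎ d ≡ b

      Inner : Fin n → Set
      Inner d = a Fin.< d × d Fin.< c

      Inner? : Decidable Inner
      Inner? d = (a Fin.<? d) ×-dec (d Fin.<? c)

      Q : Fin n → Set
      Q d = d ≡ b ⊎ Inner d

      Q? : Decidable Q
      Q? d = (d ≟ b) ⊎-dec Inner? d

      ¬Qa : ¬ Q a
      ¬Qa (inj₁ a≡b) = FinP.<⇒≢ (FinP.<-trans a<c c<b) a≡b
      ¬Qa (inj₂ (a<a , _)) = FinP.<-irrefl refl a<a

      ¬Qc : ¬ Q c
      ¬Qc (inj₁ c≡b) = FinP.<⇒≢ c<b c≡b
      ¬Qc (inj₂ (_ , c<c)) = FinP.<-irrefl refl c<c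

      off-apex : ∀ x → Supp T x → lookup x b ≡ 0 → Supp (Between a c) x
      off-apex x tx x_b≡0 d ¬ac with d ≟ b
      ... | yes refl = x_b≡0
      ... | no d≢b = tx d λ { (inj₁ ac) → ¬ac ac ; (inj₂ d≡b) → d≢b d≡b }

      off-inner : ∀ x → Supp T x → mass Inner? x ≡ 0 → Supp (Triangle a c b) x
      off-inner x tx no-inner d ¬acb with a Fin.<? d | d Fin.<? c
      ... | yes a<d | yes d<c = mass-zero Inner? x no-inner d (a<d , d<c)
      ... | yes a<d | no d≮c = tx d λ where
        (inj₁ (_ , d≤c)) → d≮c (FinP.≤∧≢⇒< d≤c λ d≡c → ¬acb (inj₂ (inj₁ d≡c)))
        (inj₂ d≡b) → ¬acb (inj₂ (inj₂ d≡b))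
      ... | no a≮d | _ = tx d λ where
        (inj₁ (a≤d , _)) → a≮d (FinP.≤∧≢⇒< a≤d λ a≡d → ¬acb (inj₁ (sym a≡d)))
        (inj₂ d≡b) → ¬acb (inj₂ (inj₂ d≡b))

      glue-apex : AgreeOn (Between a c) → AgreeOn (Triangle a c b) → AgreeOn T
      glue-apex on-ac on-face =
        mass-induction Q? (λ x → sum x ≡ m → Supp T x → Agree x) induction-step
        where
          induction-step : ∀ x →
            (∀ y → mass Q? y ℕ.< mass Q? x → sum y ≡ m → Supp T y → Agree y) →
            sum x ≡ m → Supp T x → Agree x
          induction-step x IH sx tx with lookup x b ℕ.≟ 0 | mass Inner? x ℕ.≟ 0
          ... | yes x_b≡0 | _ = on-ac x sx (off-apex x tx x_b≡0)
          ... | no _ | yes no-inner = on-face x sx (off-inner x tx no-inner)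
          ... | no x_b≢0 | no inner with mass-pos Inner? x inner
          ...   | p , (a<p , p<c) , x_p≢0
                with peel₂ x (λ p≡b → FinP.<⇒≢ (FinP.<-trans p<c c<b) p≡b) x_p≢0 x_b≢0
          ...     | i , x≡ = subst Agree (sym x≡)
                    (octahedron-bd i base-sum a<p p<c c<b
                      (descend a p Ta Tp (inj₁ ¬Qa)) (descend c b Tc Tb (inj₁ ¬Qc))
                      (descend a b Ta Tb (inj₁ ¬Qa)) (descend p c Tp Tc (inj₂ ¬Qc))
                      (descend a c Ta Tc (inj₁ ¬Qa)))
            where
              open Descent Q? x≡ sx tx (inj₂ (a<p , p<c)) (inj₁ refl) IH
              Ta : T a
              Ta = inj₁ (FinP.≤-refl , ℕP.<⇒≤ a<c)
              Tc : T c
              Tc = inj₁ (ℕP.<⇒≤ a<c , FinP.≤-refl)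
              Tp : T p
              Tp = inj₁ (ℕP.<⇒≤ a<p , ℕP.<⇒≤ p<c)
              Tb : T b
              Tb = inj₂ refl

    -- A point with
    -- mass at p ∈ [a, c) and at q ∈ (c, b) is the top of the octahedron (p, c, q, b); its other
    -- five vertices carry less mass on Q = [a, c) ∪ (c, b).
    module Span {a c b : Fin n} (a<c : a Fin.< c) (c<b : c Fin.< b) where

      Left : Fin n → Set
      Left d = a Fin.≤ d × d Fin.< c

      Left? : Decidable Left
      Left? d = (a Fin.≤? d) ×-dec (d Fin.<? c)

      Right : Fin n → Set
      Right d = c Fin.< d × d Fin.< b

      Right? : Decidable Right
      Right? d = (c Fin.<? d) ×-dec (d Fin.<? b)

      Q : Fin n → Set
      Q d = Left d ⊎ Right d

      Q? : Decidable Q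
      Q? d = Left? d ⊎-dec Right? d

      ¬Qc : ¬ Q c
      ¬Qc (inj₁ (_ , c<c)) = FinP.<-irrefl refl c<c
      ¬Qc (inj₂ (c<c , _)) = FinP.<-irrefl refl c<c

      ¬Qb : ¬ Q b
      ¬Qb (inj₁ (_ , b<c)) = FinP.<-asym b<c c<b
      ¬Qb (inj₂ (_ , b<b)) = FinP.<-irrefl refl b<b

      off-left : ∀ x → Supp (Between a b) x → mass Left? x ≡ 0 → Supp (Between c b) x
      off-left x tx no-left d ¬cb with a Fin.≤? d | d Fin.≤? b
      ... | yes a≤d | yes d≤b =
        mass-zero Left? x no-left d (a≤d , ℕP.≰⇒> λ c≤d → ¬cb (c≤d , d≤b))
      ... | no a≰d | _ = tx d λ ab → a≰d (proj₁ ab)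
      ... | _ | no d≰b = tx d λ ab → d≰b (proj₂ ab)

      off-right : ∀ x → Supp (Between a b) x → mass Right? x ≡ 0 →
                  Supp (λ d → Between a c d ⊎ d ≡ b) x
      off-right x tx no-right d ¬acb with a Fin.≤? d | d Fin.≤? b
      ... | yes a≤d | yes d≤b = mass-zero Right? x no-right d
        (ℕP.≰⇒> (λ d≤c → ¬acb (inj₁ (a≤d , d≤c))) , FinP.≤∧≢⇒< d≤b (λ d≡b → ¬acb (inj₂ d≡b)))
      ... | no a≰d | _ = tx d λ ab → a≰d (proj₁ ab)
      ... | _ | no d≰b = tx d λ ab → d≰b (proj₂ ab)

      glue-span : AgreeOn (λ d → Between a c d ⊎ d ≡ b) → AgreeOn (Between c b) →
                  AgreeOn (Between a b)
      glue-span on-acb on-cb =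
        mass-induction Q? (λ x → sum x ≡ m → Supp (Between a b) x → Agree x) induction-step
        where
          induction-step : ∀ x →
            (∀ y → mass Q? y ℕ.< mass Q? x → sum y ≡ m → Supp (Between a b) y → Agree y) →
            sum x ≡ m → Supp (Between a b) x → Agree x
          induction-step x IH sx tx with mass Left? x ℕ.≟ 0 | mass Right? x ℕ.≟ 0
          ... | yes no-left | _ = on-cb x sx (off-left x tx no-left)
          ... | no _ | yes no-right = on-acb x sx (off-right x tx no-right)
          ... | no left | no right with mass-pos Left? x left | mass-pos Right? x right
          ...   | p , (a≤p , p<c) , x_p≢0 | q , (c<q , q<b) , x_q≢0
                with peel₂ x (λ p≡q → FinP.<-asym p<c (subst (c Fin.<_) (sym p≡q) c<q))
                             x_p≢0 x_q≢0
          ...     | i , x≡ = subst Agree (sym x≡)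
                    (octahedron-ac i base-sum p<c c<q q<b
                      (descend p c Tp Tc (inj₂ ¬Qc)) (descend q b Tq Tb (inj₂ ¬Qb))
                      (descend p b Tp Tb (inj₂ ¬Qb)) (descend c q Tc Tq (inj₁ ¬Qc))
                      (descend c b Tc Tb (inj₁ ¬Qc)))
            where
              open Descent Q? x≡ sx tx (inj₁ (a≤p , p<c)) (inj₂ (c<q , q<b)) IH
              Tp : Between a b p
              Tp = a≤p , ℕP.<⇒≤ (FinP.<-trans p<c c<b)
              Tq : Between a b q
              Tq = ℕP.<⇒≤ (FinP.<-trans a<c c<q) , ℕP.<⇒≤ q<b
              Tc : Between a b c
              Tc = ℕP.<⇒≤ a<c , ℕP.<⇒≤ c<b
              Tb : Between a b b
              Tb = ℕP.<⇒≤ (FinP.<-trans a<c c<b) , FinP.≤-refl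

module Polygon where
  open import Data.Nat as ℕ using (ℕ; suc; z≤n)
  open import Data.Nat.Properties as ℕP using ()
  open import Data.Nat.DivMod using (_%_; m%n<n; m<n⇒m%n≡m; n%n≡0)
  open import Data.Fin as Fin using (Fin; toℕ; fromℕ<)
  open import Data.Fin.Properties as FinP using (_≟_; toℕ-fromℕ<; toℕ-injective; toℕ<n; fromℕ<-toℕ)
  open import Data.Product using (_×_; _,_; proj₁; proj₂; ∃; Σ)
  open import Data.Product.Properties using (≡-dec)
  open import Data.Sum using (_⊎_; inj₁; inj₂)
  open import Data.List using (List)
  open import Data.List.Membership.Propositional using (_∈_)
  import Data.List.Membership.DecPropositional as DecMembership
  open import Data.Empty using (⊥; ⊥-elim)
  open import Relation.Binary using (tri<; tri≈; tri>)
  open import Relation.Binary.PropositionalEquality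
  open import Relation.Nullary using (¬_; yes; no; Dec)
  open import Relation.Nullary.Decidable using (_⊎-dec_)
  open import Function using (case_of_)

  next-cases : ∀ {k} (a : Fin (suc k)) →
    (toℕ (next a) ≡ suc (toℕ a) × suc (toℕ a) ℕ.< suc k) ⊎
    (toℕ (next a) ≡ 0 × suc (toℕ a) ≡ suc k)
  next-cases {k} a with suc (toℕ a) ℕ.<? suc k
  ... | yes a+1<n = inj₁ (trans (toℕ-fromℕ< (m%n<n (suc (toℕ a)) (suc k))) (m<n⇒m%n≡m a+1<n) , a+1<n)
  ... | no a+1≮n = inj₂ (trans (toℕ-fromℕ< (m%n<n (suc (toℕ a)) (suc k)))
                           (trans (cong (_% suc k) a+1≡n) (n%n≡0 (suc k))) , a+1≡n)
    where
      a+1≡n : suc (toℕ a) ≡ suc k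
      a+1≡n = ℕP.≤-antisym (toℕ<n a) (ℕP.≮⇒≥ a+1≮n)

  side-cases : ∀ {k} {a b : Fin (suc k)} → a Fin.< b → BoundaryEdge a b →
               toℕ b ≡ suc (toℕ a) ⊎ (toℕ a ≡ 0 × suc (toℕ b) ≡ suc k)
  side-cases {a = a} a<b (inj₁ refl) with next-cases a
  ... | inj₁ (e , _) = inj₁ e
  ... | inj₂ (e , _) = ⊥-elim (ℕP.<-irrefl (sym e) (ℕP.≤-<-trans z≤n a<b))
  side-cases {b = b} a<b (inj₂ refl) with next-cases b
  ... | inj₁ (e , _) = ⊥-elim (ℕP.<-asym a<b (subst (toℕ b ℕ.<_) (sym e) (ℕP.n<1+n _)))
  ... | inj₂ wraps = inj₂ wraps

  next-of : ∀ {k} (a b : Fin (suc k)) → toℕ b ≡ suc (toℕ a) → b ≡ next a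
  next-of a b e with next-cases a
  ... | inj₁ (e′ , _) = toℕ-injective (trans e (sym e′))
  ... | inj₂ (_ , e′) = ⊥-elim (ℕP.<-irrefl (trans e e′) (toℕ<n b))

  next-≢ : ∀ {k} → 1 ℕ.≤ k → (a : Fin (suc k)) → a ≢ next a
  next-≢ 1≤k a a≡next with next-cases a
  ... | inj₁ (e , _) = ℕP.<-irrefl (trans (cong toℕ a≡next) e) (ℕP.n<1+n (toℕ a))
  ... | inj₂ (e , e′) =
    ℕP.<-irrefl (sym (ℕP.suc-injective (trans (sym e′) (cong suc (trans (cong toℕ a≡next) e))))) 1≤k

  triangle-side : ∀ {k} {a c b : Fin (suc k)} → a Fin.< c → c Fin.< b →
    BoundaryEdge a c ⊎ BoundaryEdge c b ⊎ BoundaryEdge a b → c ≡ next a ⊎ b ≡ next c ⊎ a ≡ next b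
  triangle-side {a = a} {c} {b} a<c c<b (inj₁ ac) with side-cases a<c ac
  ... | inj₁ e = inj₁ (next-of a c e)
  ... | inj₂ (_ , c+1≡n) =
    ⊥-elim (ℕP.<-irrefl refl (ℕP.<-≤-trans (toℕ<n b) (subst (ℕ._≤ toℕ b) c+1≡n c<b)))
  triangle-side {a = a} {c} {b} a<c c<b (inj₂ (inj₁ cb)) with side-cases c<b cb
  ... | inj₁ e = inj₂ (inj₁ (next-of c b e))
  ... | inj₂ (c≡0 , _) = ⊥-elim (ℕP.n≮0 (subst (toℕ a ℕ.<_) c≡0 a<c))
  triangle-side {a = a} {c} {b} a<c c<b (inj₂ (inj₂ ab)) with side-cases (ℕP.<-trans a<c c<b) ab
  ... | inj₁ e = ⊥-elim (ℕP.<-irrefl refl (ℕP.<-≤-trans c<b (subst (ℕ._≤ toℕ c) (sym e) a<c)))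
  ... | inj₂ (a≡0 , b+1≡n) with next-cases b
  ...   | inj₁ (_ , b+1<n) = ⊥-elim (ℕP.<-irrefl b+1≡n b+1<n)
  ...   | inj₂ (e , _) = inj₂ (inj₂ (toℕ-injective (trans a≡0 (sym e))))

  largest-below : ∀ {R : ℕ → Set} → (∀ j → Dec (R j)) → ∀ lo hi → R lo → lo ℕ.< hi →
    ∃ λ j → lo ℕ.≤ j × j ℕ.< hi × R j × (∀ j′ → j ℕ.< j′ → j′ ℕ.< hi → ¬ R j′)
  largest-below {R} R? lo (suc h) Rlo lo<hi with R? h
  ... | yes Rh = h , ℕP.≤-pred lo<hi , ℕP.n<1+n h , Rh ,
                 λ j′ h<j′ j′<h+1 → ⊥-elim (ℕP.<-irrefl refl (ℕP.<-≤-trans h<j′ (ℕP.≤-pred j′<h+1)))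
  ... | no ¬Rh with lo ℕ.≟ h
  ...   | yes refl = ⊥-elim (¬Rh Rlo)
  ...   | no lo≢h with largest-below R? lo h Rlo (ℕP.≤∧≢⇒< (ℕP.≤-pred lo<hi) lo≢h)
  ...     | j , lo≤j , j<h , Rj , above = j , lo≤j , ℕP.<-trans j<h (ℕP.n<1+n h) , Rj , above′
    where
      above′ : ∀ j′ → j ℕ.< j′ → j′ ℕ.< suc h → ¬ R j′
      above′ j′ j<j′ j′<h+1 with j′ ℕ.≟ h
      ... | yes refl = ¬Rh
      ... | no j′≢h = above j′ j<j′ (ℕP.≤∧≢⇒< (ℕP.≤-pred j′<h+1) j′≢h)

  -- Every edge a < b of a triangulation τ that is not a side [a, a + 1] is the base of a
  -- triangle (a, c, b) of τ, whose apex c is the last vertex of (a, b) joined to a.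
  module Triangulations {k : ℕ} (τ : List (Fin (suc k) × Fin (suc k)))
                        (τ-is-triangulation : IsTriangulation τ) where
    open DecMembership (≡-dec (_≟_ {suc k}) (_≟_ {suc k})) using (_∈?_)

    in-τ-is-diagonal : ∀ e → e ∈ τ → IsDiagonal e
    in-τ-is-diagonal = proj₁ τ-is-triangulation

    non-crossing : ∀ e e′ → e ∈ τ → e′ ∈ τ → ¬ Cross e e′
    non-crossing = proj₁ (proj₂ τ-is-triangulation)

    maximal : ∀ e → IsDiagonal e → ¬ e ∈ τ → ∃ λ e′ → e′ ∈ τ × Cross e e′
    maximal = proj₂ (proj₂ τ-is-triangulation)

    TEdge? : ∀ a b → Dec (TEdge τ a b)
    TEdge? a b = ((b ≟ next a) ⊎-dec (a ≟ next b)) ⊎-dec (((a , b) ∈? τ) ⊎-dec ((b , a) ∈? τ))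

    orient : ∀ {a b} → a Fin.< b → TEdge τ a b → BoundaryEdge a b ⊎ (a , b) ∈ τ
    orient a<b (inj₁ side) = inj₁ side
    orient a<b (inj₂ (inj₁ ab∈τ)) = inj₂ ab∈τ
    orient a<b (inj₂ (inj₂ ba∈τ)) = ⊥-elim (ℕP.<-asym a<b (proj₁ (in-τ-is-diagonal _ ba∈τ)))

    uncrossed : ∀ {a b} → a Fin.< b → TEdge τ a b → ∀ e → e ∈ τ → ¬ Cross (a , b) e
    uncrossed a<b ab e e∈τ cross with orient a<b ab
    ... | inj₂ ab∈τ = non-crossing _ e ab∈τ e∈τ cross
    ... | inj₁ side with side-cases a<b side | e | cross
    ...   | inj₁ b≡a+1 | (s , t) | inj₁ (a<s , s<b , _) =
            ℕP.<-irrefl refl (ℕP.<-≤-trans s<b (subst (ℕ._≤ toℕ s) (sym b≡a+1) a<s))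
    ...   | inj₁ b≡a+1 | (s , t) | inj₂ (_ , a<t , t<b) =
            ℕP.<-irrefl refl (ℕP.<-≤-trans t<b (subst (ℕ._≤ toℕ t) (sym b≡a+1) a<t))
    ...   | inj₂ (_ , b+1≡n) | (s , t) | inj₁ (_ , _ , b<t) =
            ℕP.<-irrefl refl (ℕP.<-≤-trans (toℕ<n t) (subst (ℕ._≤ toℕ t) b+1≡n b<t))
    ...   | inj₂ (a≡0 , _) | (s , t) | inj₂ (s<a , _ , _) = ℕP.n≮0 (subst (toℕ s ℕ.<_) a≡0 s<a)

    -- If c is the last vertex of (a, b) joined to a, then c is joined to b: otherwise the
    -- diagonal [c, b] is crossed by an edge [s, t] of τ, which crosses [a, b] (s < a),
    -- is an edge [a, t] with c < t < b (s = a), or crosses [a, c] (a < s).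
    last-joined-closes : ∀ {a b c} → a Fin.< b → TEdge τ a b → a Fin.< c → c Fin.< b → TEdge τ a c →
                         (∀ c′ → c Fin.< c′ → c′ Fin.< b → ¬ TEdge τ a c′) → TEdge τ c b
    last-joined-closes {a} {b} {c} a<b ab a<c c<b ac last with suc (toℕ c) ℕ.≟ toℕ b
    ... | yes c+1≡b = inj₁ (inj₁ (next-of c b (sym c+1≡b)))
    ... | no c+1≢b with (c , b) ∈? τ
    ...   | yes cb∈τ = inj₂ (inj₁ cb∈τ)
    ...   | no cb∉τ = ⊥-elim (crossing (maximal (c , b) cb-diagonal cb∉τ))
      where
        cb-diagonal : IsDiagonal (c , b)
        cb-diagonal = c<b , λ side → case side-cases c<b side of λ where
          (inj₁ b≡c+1) → c+1≢b (sym b≡c+1)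
          (inj₂ (c≡0 , _)) → ℕP.n≮0 (subst (toℕ a ℕ.<_) c≡0 a<c)
        crossing : (∃ λ e → e ∈ τ × Cross (c , b) e) → ⊥
        crossing ((s , t) , st∈τ , inj₁ (c<s , s<b , b<t)) =
          uncrossed a<b ab (s , t) st∈τ (inj₁ (ℕP.<-trans a<c c<s , s<b , b<t))
        crossing ((s , t) , st∈τ , inj₂ (s<c , c<t , t<b)) = case FinP.<-cmp s a of λ where
          (tri< s<a _ _) → uncrossed a<b ab (s , t) st∈τ (inj₂ (s<a , ℕP.<-trans a<c c<t , t<b))
          (tri≈ _ s≡a _) → last t c<t t<b (inj₂ (inj₁ (subst (λ s → (s , t) ∈ τ) s≡a st∈τ)))
          (tri> _ _ a<s) → uncrossed a<c ac (s , t) st∈τ (inj₁ (a<s , s<c , c<t))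

    JoinedTo : Fin (suc k) → ℕ → Set
    JoinedTo a j = Σ (j ℕ.< suc k) λ j<n → TEdge τ a (fromℕ< j<n)

    joined-to? : ∀ a j → Dec (JoinedTo a j)
    joined-to? a j with j ℕ.<? suc k
    ... | no j≮n = no λ joined → j≮n (proj₁ joined)
    ... | yes j<n with TEdge? a (fromℕ< j<n)
    ...   | yes e = yes (j<n , e)
    ...   | no ¬e = no λ { (_ , e) → ¬e e }

    apex : ∀ a b → a Fin.< b → TEdge τ a b → suc (toℕ a) ℕ.< toℕ b →
           ∃ λ c → a Fin.< c × c Fin.< b × TEdge τ a c × TEdge τ c b
    apex a b a<b ab gap with largest-below (joined-to? a) (suc (toℕ a)) (toℕ b) next-joined gap
      where
        a+1<n : suc (toℕ a) ℕ.< suc k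
        a+1<n = ℕP.<-trans gap (toℕ<n b)
        next-joined : JoinedTo a (suc (toℕ a))
        next-joined = a+1<n , inj₁ (inj₁ (next-of a (fromℕ< a+1<n) (toℕ-fromℕ< a+1<n)))
    ... | j , a<j , j<b , (j<n , ac) , beyond =
      c , a<c , c<b , ac , last-joined-closes a<b ab a<c c<b ac last
      where
        c : Fin (suc k)
        c = fromℕ< j<n
        toℕ-c : toℕ c ≡ j
        toℕ-c = toℕ-fromℕ< j<n
        a<c : a Fin.< c
        a<c = subst (suc (toℕ a) ℕ.≤_) (sym toℕ-c) a<j
        c<b : c Fin.< b
        c<b = subst (ℕ._< toℕ b) (sym toℕ-c) j<b
        last : ∀ c′ → c Fin.< c′ → c′ Fin.< b → ¬ TEdge τ a c′
        last c′ c<c′ c′<b ac′ = beyond (toℕ c′) (subst (ℕ._< toℕ c′) toℕ-c c<c′) c′<b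
          (toℕ<n c′ , subst (TEdge τ a) (sym (fromℕ<-toℕ c′ (toℕ<n c′))) ac′)

module Uniqueness {k m : ℕ} (1≤k : k ≥ 1)
    (τ : List (Fin (suc k) × Fin (suc k))) (τ-is-triangulation : IsTriangulation τ)
    (extroverted : Extroverted τ)
    (λs : Fin (suc k) → Vec ℤ m) (minuscule : ∀ a → Minuscule m (λs a))
    (f g : Vec ℕ (suc k) → ℤ) (hive-f : IsHive (suc k) m f) (hive-g : IsHive (suc k) m g)
    (boundary-f : HasBoundary m f λs) (boundary-g : HasBoundary m g λs)
    (diagonal-weights : ∀ a b → (a , b) ∈ τ →
                          weight m f a b ≡ weight m g a b × weight m f b a ≡ weight m g b a) where
  open Points
  open IntegerFacts
  open StepWeights
  open Polygon
  open Triangulations τ τ-is-triangulation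
  open import Data.Nat as ℕ using (zero; suc; _∸_; z≤n)
  open import Data.Nat.Properties as ℕP using ()
  open import Data.Integer using (_-_)
  open import Data.Fin as Fin using (toℕ; fromℕ<)
  open import Data.Fin.Properties as FinP using (toℕ-fromℕ<; toℕ<n; fromℕ<-toℕ; toℕ-injective)
  open import Data.Product using (_×_; _,_; ∃; proj₁; proj₂)
  open import Data.Vec using (sum)
  open import Data.Sum using (_⊎_; inj₁; inj₂)
  open import Data.Empty using (⊥-elim)
  open import Relation.Binary.PropositionalEquality
  open import Relation.Nullary using (yes; no)

  κ : ℤ
  κ = f (vertex m Fin.zero) - g (vertex m Fin.zero)

  open Agreement m f g κ
  open Gluing (proj₂ hive-f) (proj₂ hive-g)

  Pair : Fin (suc k) → Fin (suc k) → Fin (suc k) → Set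
  Pair u v d = d ≡ u ⊎ d ≡ v

  pair-swap : ∀ {u v} → AgreeOn (Pair u v) → AgreeOn (Pair v u)
  pair-swap agree x sx s =
    agree x sx (supp-weaken {x = x} (λ { _ (inj₁ e) → inj₂ e ; _ (inj₂ e) → inj₁ e }) s)

  same-side-weight : ∀ a → weight m f a (next a) ≡ weight m g a (next a)
  same-side-weight a = trans (boundary-f a) (sym (boundary-g a))

  -- f and g agree at all vertices: walk around the boundary from P_0.
  vertex-agrees : ∀ a → Agree (vertex m a)
  vertex-agrees a = subst (λ a → Agree (vertex m a)) (fromℕ<-toℕ a (toℕ<n a)) (walk (toℕ a) (toℕ<n a))
    where
      walk : ∀ j (j<n : j ℕ.< suc k) → Agree (vertex m (fromℕ< j<n))
      walk zero _ = plus-minus (f (vertex m Fin.zero)) (g (vertex m Fin.zero))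
      walk (suc j) j+1<n = subst (λ b → Agree (vertex m b)) (sym next≡)
        (segment-agrees (next-≢ 1≤k previous) (same-side-weight previous) (walk j j<n)
          (vertex m (next previous)) (sum-vertex m (next previous)) (supp-vertex m (inj₂ refl)))
        where
          j<n : j ℕ.< suc k
          j<n = ℕP.<-trans (ℕP.n<1+n j) j+1<n
          previous : Fin (suc k)
          previous = fromℕ< j<n
          next≡ : fromℕ< j+1<n ≡ next previous
          next≡ = next-of previous _ (trans (toℕ-fromℕ< j+1<n) (cong suc (sym (toℕ-fromℕ< j<n))))

  side-agrees : ∀ a → AgreeOn (Pair a (next a))
  side-agrees a = segment-agrees (next-≢ 1≤k a) (same-side-weight a) (vertex-agrees a)

  edge-agrees : ∀ {u v} → TEdge τ u v → AgreeOn (Pair u v)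
  edge-agrees {u} (inj₁ (inj₁ refl)) = side-agrees u
  edge-agrees {v = v} (inj₁ (inj₂ refl)) = pair-swap (side-agrees v)
  edge-agrees {u} {v} (inj₂ (inj₁ uv∈τ)) =
    segment-agrees (FinP.<⇒≢ (proj₁ (in-τ-is-diagonal _ uv∈τ)))
                   (proj₁ (diagonal-weights u v uv∈τ)) (vertex-agrees u)
  edge-agrees {u} {v} (inj₂ (inj₂ vu∈τ)) =
    segment-agrees (λ u≡v → FinP.<⇒≢ (proj₁ (in-τ-is-diagonal _ vu∈τ)) (sym u≡v))
                   (proj₂ (diagonal-weights v u vu∈τ)) (vertex-agrees u)

  edge-sym : ∀ {u v} → TEdge τ u v → TEdge τ v u
  edge-sym (inj₁ (inj₁ e)) = inj₁ (inj₂ e)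
  edge-sym (inj₁ (inj₂ e)) = inj₁ (inj₁ e)
  edge-sym (inj₂ (inj₁ uv∈τ)) = inj₂ (inj₂ uv∈τ)
  edge-sym (inj₂ (inj₂ vu∈τ)) = inj₂ (inj₁ vu∈τ)

  side-step-weight : ∀ a {b} → b ≡ next a →
    ∃ λ c → StepWeight c (weight m f a b) × StepWeight c (weight m g a b)
  side-step-weight a refl with minuscule-step-weight m (minuscule a)
  ... | c , W = c , subst (StepWeight c) (sym (boundary-f a)) W , subst (StepWeight c) (sym (boundary-g a)) W

  -- A triangle a < c < b of τ. Labelling it (x, y, z) with [P_x, P_y] a side of the polygon,
  -- the face lemma applies; there is one labelling for each possible boundary side.
  module TriangleOf {a c b : Fin (suc k)} (a<c : a Fin.< c) (c<b : c Fin.< b)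
                    (ac : TEdge τ a c) (cb : TEdge τ c b) (ab : TEdge τ a b) where
    a≢c : a ≢ c
    a≢c = FinP.<⇒≢ a<c
    c≢b : c ≢ b
    c≢b = FinP.<⇒≢ c<b
    a≢b : a ≢ b
    a≢b = FinP.<⇒≢ (FinP.<-trans a<c c<b)

    T : Fin (suc k) → Set
    T = Triangle a c b

    rhombi-f : ∀ p → sum p ℕ.+ 2 ≡ m → Supp T p →
               Rhombus f a c b p × Rhombus f c a b p × Rhombus f b a c p
    rhombi-f = face-rhombi {f} (proj₁ hive-f) a<c c<b
    rhombi-g : ∀ p → sum p ℕ.+ 2 ≡ m → Supp T p →
               Rhombus g a c b p × Rhombus g c a b p × Rhombus g b a c p
    rhombi-g = face-rhombi {g} (proj₁ hive-g) a<c c<b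

    side-ac : c ≡ next a → AgreeOn T
    side-ac c≡next-a with side-step-weight a c≡next-a
    ... | _ , Wf , Wg = Face.face-agrees a≢c c≢b a≢b T
      (inj₁ refl) (inj₂ (inj₁ refl)) (inj₂ (inj₂ refl)) (λ _ t → t)
      (λ p e s → proj₁ (rhombi-f p e s)) (λ p e s → proj₁ (proj₂ (rhombi-f p e s)))
      (λ p e s → proj₁ (rhombi-g p e s)) (λ p e s → proj₁ (proj₂ (rhombi-g p e s)))
      Wf Wg (edge-agrees ab) (edge-agrees cb)

    side-cb : b ≡ next c → AgreeOn T
    side-cb b≡next-c with side-step-weight c b≡next-c
    ... | _ , Wf , Wg = Face.face-agrees c≢b (λ b≡a → a≢b (sym b≡a)) (λ c≡a → a≢c (sym c≡a)) T
      (inj₂ (inj₁ refl)) (inj₂ (inj₂ refl)) (inj₁ refl)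
      (λ { _ (inj₁ e) → inj₂ (inj₂ e) ; _ (inj₂ (inj₁ e)) → inj₁ e ; _ (inj₂ (inj₂ e)) → inj₂ (inj₁ e) })
      (λ p e s → rhombus-sym f c a b p (proj₁ (proj₂ (rhombi-f p e s))))
      (λ p e s → rhombus-sym f b a c p (proj₂ (proj₂ (rhombi-f p e s))))
      (λ p e s → rhombus-sym g c a b p (proj₁ (proj₂ (rhombi-g p e s))))
      (λ p e s → rhombus-sym g b a c p (proj₂ (proj₂ (rhombi-g p e s))))
      Wf Wg (edge-agrees (edge-sym ac)) (edge-agrees (edge-sym ab))

    side-ba : a ≡ next b → AgreeOn T
    side-ba a≡next-b with side-step-weight b a≡next-b
    ... | _ , Wf , Wg = Face.face-agrees (λ b≡a → a≢b (sym b≡a)) a≢c (λ b≡c → c≢b (sym b≡c)) T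
      (inj₂ (inj₂ refl)) (inj₁ refl) (inj₂ (inj₁ refl))
      (λ { _ (inj₁ e) → inj₂ (inj₁ e) ; _ (inj₂ (inj₁ e)) → inj₂ (inj₂ e) ; _ (inj₂ (inj₂ e)) → inj₁ e })
      (λ p e s → proj₂ (proj₂ (rhombi-f p e s))) (λ p e s → rhombus-sym f a c b p (proj₁ (rhombi-f p e s)))
      (λ p e s → proj₂ (proj₂ (rhombi-g p e s))) (λ p e s → rhombus-sym g a c b p (proj₁ (rhombi-g p e s)))
      Wf Wg (edge-agrees (edge-sym cb)) (edge-agrees ac)

  -- f and g agree on every triangle a < c < b of τ, since, τ being extroverted, it has a side
  -- on the boundary of the polygon.
  triangle-agrees : ∀ {a c b} → a Fin.< c → c Fin.< b → TEdge τ a c → TEdge τ c b → TEdge τ a b →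
                    AgreeOn (Triangle a c b)
  triangle-agrees {a} {c} {b} a<c c<b ac cb ab
    with triangle-side a<c c<b (extroverted a c b a<c c<b ac cb ab)
  ... | inj₁ c≡next-a = TriangleOf.side-ac a<c c<b ac cb ab c≡next-a
  ... | inj₂ (inj₁ b≡next-c) = TriangleOf.side-cb a<c c<b ac cb ab b≡next-c
  ... | inj₂ (inj₂ a≡next-b) = TriangleOf.side-ba a<c c<b ac cb ab a≡next-b

  -- f and g agree on every interval [a, b] spanned by an edge a < b of τ, by induction on b − a:
  -- a side [a, a + 1] is an edge; otherwise [a, b] is the base of a triangle (a, c, b) of τ and
  -- the two gluing steps join [a, c], the triangle and [c, b].
  interval-agrees : ∀ N {a b} → toℕ b ∸ toℕ a ℕ.≤ N → a Fin.< b → TEdge τ a b →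
                    AgreeOn (Between a b)
  interval-agrees zero b-a≤0 a<b _ = ⊥-elim (ℕP.<⇒≱ a<b (ℕP.m∸n≡0⇒m≤n (ℕP.n≤0⇒n≡0 b-a≤0)))
  interval-agrees (suc N) {a} {b} b-a≤N+1 a<b ab with suc (toℕ a) ℕ.≟ toℕ b
  ... | yes a+1≡b = λ x sx s → edge-agrees ab x sx (supp-weaken {x = x} endpoint s)
    where
      endpoint : ∀ d → Between a b d → Pair a b d
      endpoint d (a≤d , d≤b) with toℕ a ℕ.≟ toℕ d
      ... | yes a≡d = inj₁ (toℕ-injective (sym a≡d))
      ... | no a≢d =
        inj₂ (toℕ-injective (ℕP.≤-antisym d≤b (subst (ℕ._≤ toℕ d) a+1≡b (ℕP.≤∧≢⇒< a≤d a≢d))))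
  ... | no a+1≢b with apex a b a<b ab (ℕP.≤∧≢⇒< a<b a+1≢b)
  ...   | c , a<c , c<b , ac , cb =
    Span.glue-span a<c c<b
      (Apex.glue-apex a<c c<b (interval-agrees N c-a≤N a<c ac) (triangle-agrees a<c c<b ac cb ab))
      (interval-agrees N b-c≤N c<b cb)
    where
      c-a≤N : toℕ c ∸ toℕ a ℕ.≤ N
      c-a≤N = ℕP.≤-pred (ℕP.<-≤-trans (ℕP.∸-monoˡ-< c<b (ℕP.<⇒≤ a<c)) b-a≤N+1)
      b-c≤N : toℕ b ∸ toℕ c ℕ.≤ N
      b-c≤N = ℕP.≤-pred (ℕP.<-≤-trans (ℕP.∸-monoʳ-< a<c (ℕP.<⇒≤ c<b)) b-a≤N+1)

  -- The closing side [0, k] spans the whole polygon.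
  all-agree : ∀ x → sum x ≡ m → Agree x
  all-agree x sx = interval-agrees k (ℕP.≤-reflexive (FinP.toℕ-fromℕ k)) 0<k closing-side x sx everywhere
    where
      0<k : Fin.zero {k} Fin.< Fin.fromℕ k
      0<k = subst (0 ℕ.<_) (sym (FinP.toℕ-fromℕ k)) 1≤k
      closing-side : TEdge τ Fin.zero (Fin.fromℕ k)
      closing-side with next-cases (Fin.fromℕ k)
      ... | inj₁ (_ , k+1<k+1) = ⊥-elim (ℕP.<-irrefl (cong suc (FinP.toℕ-fromℕ k)) k+1<k+1)
      ... | inj₂ (wraps , _) = inj₁ (inj₂ (toℕ-injective (sym wraps)))
      everywhere : Supp (Between Fin.zero (Fin.fromℕ k)) x
      everywhere d outside = ⊥-elim (outside (z≤n , FinP.≤fromℕ d))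

corollary3p7 : (n m : ℕ) → n ≥ 3 →
    (τ : List (Fin n × Fin n)) → IsTriangulation τ → Extroverted τ →
    (λs : Fin n → Vec ℤ m) → (∀ a → Minuscule m (λs a)) →
    (f g : Vec ℕ n → ℤ) → IsHive n m f → IsHive n m g →
    HasBoundary m f λs → HasBoundary m g λs →
    (∀ a b → (a , b) ∈ τ → weight m f a b ≡ weight m g a b × weight m f b a ≡ weight m g b a) →
    HiveEq n m f g
corollary3p7 (suc k) m (s≤s (s≤s (s≤s z≤n))) τ triangulation extroverted λs minuscule f g
             hive-f hive-g boundary-f boundary-g diagonal-weights =
  κ , all-agree
  where
    open Uniqueness (s≤s z≤n) τ triangulation extroverted λs minuscule f g
                    hive-f hive-g boundary-f boundary-g diagonal-weights
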